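{- Let $e=2.718281\ldots$ be Euler's number and let $s_k/t_k$, $k\ge 0$, be the convergents of its regular continued fraction expansion. Then the Jacobi sequence of $e$ is purely periodic with period length $24$, i.e. $$\left(\frac{s_k}{t_k}\right)=\left(\frac{s_{k+24}}{t_{k+24}}\right)\quad\text{for all }k\ge 0,$$ and $24$ is the smallest possible period length of the Jacobi sequence of $e$.
   Context: For $x\in\mathbb{R}\setminus\mathbb{Q}$ with regular continued fraction expansion $x=[a_0,a_1,a_2,\ldots]$ ($a_0\in\mathbb{Z}$, $a_k\ge 1$ for $k\ge1$), the convergents $s_k/t_k=[a_0,\ldots,a_k]$ are defined by $s_{ -1}=1$, $s_0=a_0$, $s_k=a_ks_{k-1}+s_{k-2}$ and $t_{ -1}=0$, $t_0=1$, $t_k=a_kt_{k-1}+t_{k-2}$ for $k\ge1$. For an odd natural number $n$ and an integer $m$ with $\gcd(m,n)=1$, $\left(\frac{m}{n}\right)$ denotes the Jacobi symbol (with $\left(\frac{0}{1}\right)=1$). If $n$ is even and $\gcd(m,n)=1$, one sets $\left(\frac{m}{n}\right)=*$, where $*$ is a fixed symbol different from $\pm1$. The Jacobi sequence of $x$ is the sequence $\left(\frac{s_k}{t_k}\right)$, $k\ge0$, with values in $\{1,-1,*\}$. -}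

module Defs where

open import Data.Nat using (ℕ; zero; suc; _+_; _*_; _%_; _/_; _≡ᵇ_; _≤ᵇ_)
open import Data.Bool using (Bool; true; false; if_then_else_; _∧_)
open import Data.Integer using (ℤ; +_; -[1+_]) renaming (_*_ to _*ℤ_)
open import Data.List using (List; upTo)
open import Data.Bool.ListAction using (any)

-- Partial quotients of the regular continued fraction of e
-- (Euler): e = [2; 1, 2, 1, 1, 4, 1, 1, 6, ...], i.e.
--   a_0 = 2,  a_k = 2(k+1)/3 if k ≡ 2 (mod 3),  a_k = 1 otherwise (k ≥ 1).

eCF : ℕ → ℕ
eCF zero = 2
eCF (suc k) with (suc k) % 3
... | 2 = (2 * (suc k + 1)) / 3
... | _ = 1

-- Shifted numerators / denominators:  S n = s_{n-1},  T n = t_{n-1},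
-- so that S 0 = s_{-1} = 1, S 1 = s_0 = a_0, T 0 = t_{-1} = 0, T 1 = t_0 = 1.
S : ℕ → ℕ
S zero = 1
S (suc zero) = eCF 0
S (suc (suc k)) = eCF (suc k) * S (suc k) + S k

T : ℕ → ℕ
T zero = 0
T (suc zero) = 1
T (suc (suc k)) = eCF (suc k) * T (suc k) + T k

s : ℕ → ℕ
s k = S (suc k)

t : ℕ → ℕ
t k = T (suc k)

legendre : ℕ → ℕ → ℤ
legendre m zero = + 0
legendre m p@(suc _) =
  if m % p ≡ᵇ 0 then + 0
  else if any (λ x → (x * x) % p ≡ᵇ m % p) (upTo p) then + 1
  else -[1+ 0 ]

leastDivFrom : ℕ → ℕ → ℕ → ℕ
leastDivFrom zero d n = n
leastDivFrom (suc fuel) zero n = leastDivFrom fuel 2 n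
leastDivFrom (suc fuel) d@(suc _) n =
  if (2 ≤ᵇ d) ∧ (n % d ≡ᵇ 0) then d else leastDivFrom fuel (suc d) n

lpf : ℕ → ℕ
lpf n = leastDivFrom n 2 n

jacobiF : ℕ → ℕ → ℕ → ℤ
jacobiF zero m n = + 1
jacobiF (suc fuel) m zero = + 1
jacobiF (suc fuel) m (suc zero) = + 1
jacobiF (suc fuel) m n@(suc (suc _)) with lpf n
... | zero = + 1
... | p@(suc _) = legendre m p *ℤ jacobiF fuel m (n / p)

jacobi : ℕ → ℕ → ℤ
jacobi m n = jacobiF n m n

-- Values of the Jacobi sequence: ±1, or the symbol * for even denominators.

data JVal : Set where
  sym  : ℤ → JVal
  star : JVal

isEven : ℕ → Bool
isEven n = n % 2 ≡ᵇ 0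

jacobiSeqVal : ℕ → ℕ → JVal
jacobiSeqVal m n = if isEven n then star else sym (jacobi m n)

eJacobiSeq : ℕ → JVal
eJacobiSeq k = jacobiSeqVal (s k) (t k)

module Submission where

-- The Jacobi symbol of Defs is the product of the Legendre symbols over the prime factorisation,
-- so from quadratic reciprocity (via Gauss's lemma, Euler's criterion and Eisenstein's lattice
-- point count) it inherits the rules (a/n) = (b/n) for a ≡ b (mod n), multiplicativity in a,
-- ((n-1)/n) = (-1)^((n-1)/2) and (m/n)(n/m) = (-1)^((m-1)/2 · (n-1)/2).
-- For the convergents of e, s_k t_{k-1} - s_{k-1} t_k = ±1 gives (s_k/t_k) = ±(t_{k-1}/t_k), and
-- reciprocity together with t_{k+1} ≡ t_{k-1} (mod t_k) expresses (t_k/t_{k+1}) through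
-- (t_{k-1}/t_k) and signs depending only on the t_j mod 4. The partial quotients of e, hence the
-- t_k, are periodic mod 4 with period 24, and so is the Jacobi sequence; that no shorter period
-- occurs, even eventually, is read off its first 26 terms.

open import Data.Nat as ℕ using (ℕ; suc)
open import Data.Nat.Primality using (Prime)

module BigOperators where

  open import Relation.Binary.PropositionalEquality as ≡ using (_≡_; _≢_; cong; subst)
  open import Algebra.Bundles using (CommutativeMonoid)
  open import Data.Nat as ℕ using (ℕ; suc; _≤_; s≤s; z≤n)
  import Data.Nat.Properties as ℕ
  import Data.Integer.Properties as ℤ
  open import Data.List using (List; []; _∷_; _++_; map; length; applyDownFrom)
  open import Data.List.Properties using (length-map; length-applyDownFrom)
  open import Data.List.Membership.Propositional using (_∈_)
  open import Data.List.Membership.Propositional.Properties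
    using (∈-∃++; ∈-map⁻; ∈-applyDownFrom⁺; ∈-applyDownFrom⁻)
  open import Data.List.Relation.Unary.Any using (here; there)
  open import Data.List.Relation.Unary.All as All using (All; []; _∷_)
  open import Data.List.Relation.Unary.All.Properties using () renaming (map⁺ to All-map⁺)
  open import Data.List.Relation.Unary.AllPairs using ([]; _∷_)
  open import Data.List.Relation.Unary.Unique.Propositional using (Unique)
  import Data.List.Relation.Unary.Unique.Propositional.Properties as Unique
  open import Data.List.Relation.Binary.Permutation.Propositional as ↭
    using (_↭_; ↭-sym; ↭⇒↭ₛ)
  open import Data.List.Relation.Binary.Permutation.Propositional.Properties
    using (shift; ↭-length; ∈-resp-↭)
  open import Data.List.Relation.Binary.Permutation.Setoid.Properties (≡.setoid ℕ)
    using (Unique-resp-↭)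
  open import Data.Product using (_×_; _,_)
  open import Data.Empty using (⊥-elim)

  range : ℕ → List ℕ
  range = applyDownFrom suc

  ∈-range⁺ : ∀ {n x} → 1 ≤ x → x ≤ n → x ∈ range n
  ∈-range⁺ {x = suc x} _ x<n = ∈-applyDownFrom⁺ suc x<n

  ∈-range⁻ : ∀ {n x} → x ∈ range n → 1 ≤ x × x ≤ n
  ∈-range⁻ x∈ with ∈-applyDownFrom⁻ suc x∈
  ... | _ , i<n , ≡.refl = s≤s z≤n , i<n

  range-unique : ∀ n → Unique (range n)
  range-unique n = Unique.applyDownFrom⁺₁ suc n (λ j<i _ eq → ℕ.<⇒≢ j<i (≡.sym (ℕ.suc-injective eq)))

  length-range : ∀ n → length (range n) ≡ n
  length-range = length-applyDownFrom suc

  module _ {v : ℕ} (as : List ℕ) {bs : List ℕ} where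

    ∈-insert : ∀ {y} → y ∈ as ++ bs → y ∈ as ++ v ∷ bs
    ∈-insert y∈ = ∈-resp-↭ (↭-sym (shift v as bs)) (there y∈)

    ∈-delete : ∀ {y} → y ∈ as ++ v ∷ bs → y ≢ v → y ∈ as ++ bs
    ∈-delete y∈ y≢v with ∈-resp-↭ (shift v as bs) y∈
    ... | here y≡v = ⊥-elim (y≢v y≡v)
    ... | there y∈′ = y∈′

    unique-shift : Unique (as ++ v ∷ bs) → Unique (v ∷ as ++ bs)
    unique-shift = Unique-resp-↭ (↭⇒↭ₛ (shift v as bs))

  unique-map : ∀ (f : ℕ → ℕ) xs → Unique xs →
               (∀ {i j} → i ∈ xs → j ∈ xs → f i ≡ f j → i ≡ j) → Unique (map f xs)
  unique-map f []       _          _   = []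
  unique-map f (x ∷ xs) (x∉ ∷ xs!) inj =
    All-map⁺ (All.tabulate (λ y∈ fx≡fy → All.lookup x∉ y∈ (inj (here ≡.refl) (there y∈) fx≡fy)))
    ∷ unique-map f xs xs! (λ i∈ j∈ → inj (there i∈) (there j∈))

  unique∧⊆∧length≤⇒↭ : ∀ (xs ys : List ℕ) → Unique xs → (∀ {x} → x ∈ xs → x ∈ ys) →
                       length ys ≤ length xs → xs ↭ ys
  unique∧⊆∧length≤⇒↭ []       []       _          _   _   = ↭.refl
  unique∧⊆∧length≤⇒↭ (x ∷ xs) ys       (x∉ ∷ xs!) xs⊆ys len with ∈-∃++ (xs⊆ys (here ≡.refl))
  ... | as , bs , ≡.refl =
    ↭.trans (↭.prep x (unique∧⊆∧length≤⇒↭ xs (as ++ bs) xs! xs⊆as++bs len′)) (↭-sym (shift x as bs))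
    where
    xs⊆as++bs : ∀ {y} → y ∈ xs → y ∈ as ++ bs
    xs⊆as++bs y∈ = ∈-delete as (xs⊆ys (there y∈)) (λ y≡x → All.lookup x∉ y∈ (≡.sym y≡x))
    len′ : length (as ++ bs) ≤ length xs
    len′ = ℕ.≤-pred (subst (_≤ suc (length xs)) (↭-length (shift x as bs)) len)

  injective⇒map-↭ : ∀ (f : ℕ → ℕ) xs → Unique xs → (∀ {x} → x ∈ xs → f x ∈ xs) →
                    (∀ {i j} → i ∈ xs → j ∈ xs → f i ≡ f j → i ≡ j) → map f xs ↭ xs
  injective⇒map-↭ f xs xs! into inj =
    unique∧⊆∧length≤⇒↭ (map f xs) xs (unique-map f xs xs! inj) f[xs]⊆xs
      (ℕ.≤-reflexive (≡.sym (length-map f xs)))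
    where
    f[xs]⊆xs : ∀ {y} → y ∈ map f xs → y ∈ xs
    f[xs]⊆xs y∈ with ∈-map⁻ f y∈
    ... | _ , x∈ , ≡.refl = into x∈

  module Fold {c ℓ} (M : CommutativeMonoid c ℓ) where

    open CommutativeMonoid M
    open import Relation.Binary.Reasoning.Setoid setoid

    ⨁ : {A : Set} → (A → Carrier) → List A → Carrier
    ⨁ f []       = ε
    ⨁ f (x ∷ xs) = f x ∙ ⨁ f xs

    module _ {A : Set} where

      ⨁-↭ : ∀ (f : A → Carrier) {xs ys} → xs ↭ ys → ⨁ f xs ≈ ⨁ f ys
      ⨁-↭ f ↭.refl               = refl
      ⨁-↭ f (↭.prep x p)         = ∙-congˡ (⨁-↭ f p)
      ⨁-↭ f {_ ∷ _ ∷ xs} {_ ∷ _ ∷ ys} (↭.swap x y p) = begin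
        f x ∙ (f y ∙ ⨁ f xs) ≈⟨ ∙-congˡ (∙-congˡ (⨁-↭ f p)) ⟩
        f x ∙ (f y ∙ ⨁ f ys) ≈⟨ assoc (f x) (f y) (⨁ f ys) ⟨
        f x ∙ f y ∙ ⨁ f ys   ≈⟨ ∙-congʳ (comm (f x) (f y)) ⟩
        f y ∙ f x ∙ ⨁ f ys   ≈⟨ assoc (f y) (f x) (⨁ f ys) ⟩
        f y ∙ (f x ∙ ⨁ f ys) ∎
      ⨁-↭ f (↭.trans p q)       = trans (⨁-↭ f p) (⨁-↭ f q)

      ⨁-cong : ∀ {f g : A → Carrier} xs → (∀ {x} → x ∈ xs → f x ≈ g x) → ⨁ f xs ≈ ⨁ g xs
      ⨁-cong []       _     = refl
      ⨁-cong (x ∷ xs) f≈g = ∙-cong (f≈g (here ≡.refl)) (⨁-cong xs (λ x∈ → f≈g (there x∈)))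

      ⨁-ε : ∀ (xs : List A) → ⨁ (λ _ → ε) xs ≈ ε
      ⨁-ε []       = refl
      ⨁-ε (x ∷ xs) = trans (identityˡ _) (⨁-ε xs)

      ⨁-∙ : ∀ (f g : A → Carrier) xs → ⨁ (λ x → f x ∙ g x) xs ≈ ⨁ f xs ∙ ⨁ g xs
      ⨁-∙ f g []       = sym (identityˡ ε)
      ⨁-∙ f g (x ∷ xs) = begin
        f x ∙ g x ∙ ⨁ (λ x → f x ∙ g x) xs ≈⟨ ∙-congˡ (⨁-∙ f g xs) ⟩
        f x ∙ g x ∙ (⨁ f xs ∙ ⨁ g xs)      ≈⟨ interchange ⟩
        f x ∙ ⨁ f xs ∙ (g x ∙ ⨁ g xs)      ∎
        where
        interchange : ∀ {a b u v} → a ∙ b ∙ (u ∙ v) ≈ a ∙ u ∙ (b ∙ v)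
        interchange {a} {b} {u} {v} = begin
          a ∙ b ∙ (u ∙ v)   ≈⟨ assoc a b (u ∙ v) ⟩
          a ∙ (b ∙ (u ∙ v)) ≈⟨ ∙-congˡ (assoc b u v) ⟨
          a ∙ (b ∙ u ∙ v)   ≈⟨ ∙-congˡ (∙-congʳ (comm b u)) ⟩
          a ∙ (u ∙ b ∙ v)   ≈⟨ ∙-congˡ (assoc u b v) ⟩
          a ∙ (u ∙ (b ∙ v)) ≈⟨ assoc a u (b ∙ v) ⟨
          a ∙ u ∙ (b ∙ v)   ∎

    ⨁-map : ∀ {A B : Set} (f : B → Carrier) (g : A → B) xs → ⨁ f (map g xs) ≡ ⨁ (λ x → f (g x)) xs
    ⨁-map f g []       = ≡.refl
    ⨁-map f g (x ∷ xs) = cong (f (g x) ∙_) (⨁-map f g xs)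

    ⨁-swap : ∀ {A B : Set} (f : A → B → Carrier) xs ys →
             ⨁ (λ x → ⨁ (f x) ys) xs ≈ ⨁ (λ y → ⨁ (λ x → f x y) xs) ys
    ⨁-swap f []       ys = sym (⨁-ε ys)
    ⨁-swap f (x ∷ xs) ys = begin
      ⨁ (f x) ys ∙ ⨁ (λ x → ⨁ (f x) ys) xs           ≈⟨ ∙-congˡ (⨁-swap f xs ys) ⟩
      ⨁ (f x) ys ∙ ⨁ (λ y → ⨁ (λ x → f x y) xs) ys   ≈⟨ ⨁-∙ (f x) (λ y → ⨁ (λ x → f x y) xs) ys ⟨
      ⨁ (λ y → f x y ∙ ⨁ (λ x → f x y) xs) ys        ∎

  open Fold ℕ.+-0-commutativeMonoid public using ()
    renaming (⨁ to ∑; ⨁-↭ to ∑-↭; ⨁-cong to ∑-cong; ⨁-∙ to ∑-+; ⨁-map to ∑-map; ⨁-swap to ∑-swap)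

  open Fold ℤ.*-1-commutativeMonoid public using ()
    renaming (⨁ to ∏; ⨁-↭ to ∏-↭; ⨁-cong to ∏-cong; ⨁-ε to ∏-1; ⨁-∙ to ∏-*; ⨁-map to ∏-map; ⨁-swap to ∏-swap)

  ∑-*ˡ : ∀ {A : Set} c (f : A → ℕ) xs → ∑ (λ x → c ℕ.* f x) xs ≡ c ℕ.* ∑ f xs
  ∑-*ˡ c f []       = ≡.sym (ℕ.*-zeroʳ c)
  ∑-*ˡ c f (x ∷ xs) = ≡.trans (cong (c ℕ.* f x ℕ.+_) (∑-*ˡ c f xs)) (≡.sym (ℕ.*-distribˡ-+ c (f x) (∑ f xs)))

  ∑-const : ∀ {A : Set} c (xs : List A) → ∑ (λ _ → c) xs ≡ length xs ℕ.* c
  ∑-const c []       = ≡.refl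
  ∑-const c (x ∷ xs) = cong (c ℕ.+_) (∑-const c xs)

module Congruence (n : ℕ) where

  open import Data.Nat as ℕ using (ℕ; zero; suc; NonZero; _%_; _/_; _∸_)
  import Data.Nat.Properties as ℕ
  import Data.Nat.DivMod as ℕ
  import Data.Nat.Divisibility as ℕ
  open import Data.Nat.Primality using (Prime; euclidsLemma)
  open import Data.Integer using (ℤ; +_; _+_; _*_; _-_; -_; ∣_∣; _^_)
  import Data.Integer.Properties as ℤ
  open import Data.Integer.Divisibility.Signed
    using (_∣_; divides; ∣m∣n⇒∣m+n; ∣⇒∣ᵤ; ∣ᵤ⇒∣; ∣n⇒∣m*n; ∣m⇒∣m*n; ∣m⇒∣-m)
  open import Data.Integer.Tactic.RingSolver using (solve-∀)
  open import Data.Empty using (⊥-elim)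
  open import Data.Product using (∃-syntax; _×_; _,_)
  open import Data.Sum using (_⊎_; inj₁; inj₂)
  open import Data.List using (List; []; _∷_; _++_; length)
  open import Data.List.Membership.Propositional using (_∈_)
  open import Data.List.Membership.Propositional.Properties using (∈-∃++)
  open import Data.List.Relation.Unary.Any using (here; there)
  open import Data.List.Relation.Unary.All as All using ()
  open import Data.List.Relation.Unary.AllPairs using (_∷_)
  open import Data.List.Relation.Unary.Unique.Propositional using (Unique)
  open import Data.List.Relation.Binary.Permutation.Propositional.Properties using (shift; ↭-length)
  open import Level using (0ℓ)
  open import Relation.Binary.Bundles using (Setoid)
  open import Relation.Binary.Structures using (IsEquivalence)
  open import Relation.Binary.PropositionalEquality
  open import Relation.Nullary using (¬_)
  open BigOperators using (∏; ∏-↭; ∈-insert; ∈-delete; unique-shift)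

  infix 4 _≈_

  -- a record rather than a synonym for + n ∣ a - b, so that a and b stay inferable
  record _≈_ (a b : ℤ) : Set where
    constructor mk≈
    field divides-difference : + n ∣ a - b

  ≈-refl : ∀ {a} → a ≈ a
  ≈-refl {a} = mk≈ (divides (+ 0) (a-a≡0*n a (+ n)))
    where
    a-a≡0*n : ∀ a n → a - a ≡ + 0 * n
    a-a≡0*n = solve-∀

  ≈-reflexive : ∀ {a b} → a ≡ b → a ≈ b
  ≈-reflexive refl = ≈-refl

  ≈-sym : ∀ {a b} → a ≈ b → b ≈ a
  ≈-sym {a} {b} (mk≈ d) = mk≈ (subst (+ n ∣_) (neg-diff a b) (∣m⇒∣-m d))
    where
    neg-diff : ∀ a b → - (a - b) ≡ b - a
    neg-diff = solve-∀

  ≈-trans : ∀ {a b c} → a ≈ b → b ≈ c → a ≈ c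
  ≈-trans {a} {b} {c} (mk≈ d) (mk≈ e) = mk≈ (subst (+ n ∣_) (telescope a b c) (∣m∣n⇒∣m+n d e))
    where
    telescope : ∀ a b c → (a - b) + (b - c) ≡ a - c
    telescope = solve-∀

  ≈-isEquivalence : IsEquivalence _≈_
  ≈-isEquivalence = record { refl = ≈-refl ; sym = ≈-sym ; trans = ≈-trans }

  ≈-setoid : Setoid 0ℓ 0ℓ
  ≈-setoid = record { isEquivalence = ≈-isEquivalence }

  +-cong : ∀ {a b c d} → a ≈ b → c ≈ d → a + c ≈ b + d
  +-cong {a} {b} {c} {d} (mk≈ x) (mk≈ y) = mk≈ (subst (+ n ∣_) (diff-+ a b c d) (∣m∣n⇒∣m+n x y))
    where
    diff-+ : ∀ a b c d → (a - b) + (c - d) ≡ (a + c) - (b + d)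
    diff-+ = solve-∀

  *-cong : ∀ {a b c d} → a ≈ b → c ≈ d → a * c ≈ b * d
  *-cong {a} {b} {c} {d} (mk≈ x) (mk≈ y) =
    mk≈ (subst (+ n ∣_) (diff-* a b c d) (∣m∣n⇒∣m+n (∣n⇒∣m*n a y) (∣m⇒∣m*n d x)))
    where
    diff-* : ∀ a b c d → a * (c - d) + (a - b) * d ≡ a * c - b * d
    diff-* = solve-∀

  -‿cong : ∀ {a b} → a ≈ b → - a ≈ - b
  -‿cong {a} {b} (mk≈ x) = mk≈ (subst (+ n ∣_) (diff-neg a b) (∣m⇒∣-m x))
    where
    diff-neg : ∀ a b → - (a - b) ≡ (- a) - (- b)
    diff-neg = solve-∀

  *-congˡ : ∀ c {a b} → a ≈ b → c * a ≈ c * b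
  *-congˡ c = *-cong (≈-refl {c})

  *-congʳ : ∀ c {a b} → a ≈ b → a * c ≈ b * c
  *-congʳ c a≈b = *-cong a≈b (≈-refl {c})

  ^-cong : ∀ {a b} k → a ≈ b → a ^ k ≈ b ^ k
  ^-cong zero    _   = ≈-refl
  ^-cong (suc k) a≈b = *-cong a≈b (^-cong k a≈b)

  n≈0 : + n ≈ + 0
  n≈0 = mk≈ (divides (+ 1) (n-0≡1*n (+ n)))
    where
    n-0≡1*n : ∀ x → x - + 0 ≡ + 1 * x
    n-0≡1*n = solve-∀

  ≈⇒-≈0 : ∀ {a b} → a ≈ b → a - b ≈ + 0
  ≈⇒-≈0 {a} {b} (mk≈ d) = mk≈ (subst (+ n ∣_) (sym (ℤ.+-identityʳ (a - b))) d)

  -≈0⇒≈ : ∀ {a b} → a - b ≈ + 0 → a ≈ b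
  -≈0⇒≈ {a} {b} (mk≈ d) = mk≈ (subst (+ n ∣_) (ℤ.+-identityʳ (a - b)) d)

  ≈0⇒∣ : ∀ {a} → a ≈ + 0 → n ℕ.∣ ∣ a ∣
  ≈0⇒∣ {a} (mk≈ d) = subst (λ z → n ℕ.∣ ∣ z ∣) (ℤ.+-identityʳ a) (∣⇒∣ᵤ d)

  ∣⇒≈0 : ∀ {a} → n ℕ.∣ ∣ a ∣ → a ≈ + 0
  ∣⇒≈0 {a} d = mk≈ (∣ᵤ⇒∣ (subst (λ z → n ℕ.∣ ∣ z ∣) (sym (ℤ.+-identityʳ a)) d))

  ≈0-≤ : ∀ {a} → ℕ.NonZero a → + a ≈ + 0 → n ℕ.≤ a
  ≈0-≤ {a} a≢0 a≈0 = ℕ.∣⇒≤ {{a≢0}} (≈0⇒∣ a≈0)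

  module _ .{{_ : NonZero n}} where

    %-≈ : ∀ a → + (a % n) ≈ + a
    %-≈ a = ≈-sym (mk≈ (divides (+ (a / n)) a-a%n≡[a/n]*n))
      where
      open ≡-Reasoning
      cancel : ∀ x y → (x + y) - x ≡ y
      cancel = solve-∀
      a-a%n≡[a/n]*n : + a - + (a % n) ≡ + (a / n) * + n
      a-a%n≡[a/n]*n = begin
        + a - + (a % n)                        ≡⟨ cong (λ z → + z - + (a % n)) (ℕ.m≡m%n+[m/n]*n a n) ⟩
        + (a % n ℕ.+ a / n ℕ.* n) - + (a % n)  ≡⟨ cong (_- + (a % n)) (ℤ.pos-+ (a % n) (a / n ℕ.* n)) ⟩
        (+ (a % n) + + (a / n ℕ.* n)) - + (a % n) ≡⟨ cancel (+ (a % n)) (+ (a / n ℕ.* n)) ⟩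
        + (a / n ℕ.* n)                        ≡⟨ ℤ.pos-* (a / n) n ⟩
        + (a / n) * + n                        ∎

    %≡⇒≈ : ∀ {a b} → a % n ≡ b % n → + a ≈ + b
    %≡⇒≈ {a} {b} eq = ≈-trans (≈-sym (%-≈ a)) (≈-trans (≈-reflexive (cong +_ eq)) (%-≈ b))

    private
      ≤-≈⇒≡ : ∀ {i j} → i ℕ.≤ j → j ℕ.< n → + j ≈ + i → j ≡ i
      ≤-≈⇒≡ {i} {j} i≤j j<n (mk≈ d) = ℕ.≤-antisym (ℕ.m∸n≡0⇒m≤n j∸i≡0) i≤j
        where
        n∣j∸i : n ℕ.∣ (j ∸ i)
        n∣j∸i = ∣⇒∣ᵤ (subst (+ n ∣_) (trans (ℤ.m-n≡m⊖n j i) (ℤ.⊖-≥ i≤j)) d)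
        j∸i≡0 : j ∸ i ≡ 0
        j∸i≡0 = trans (sym (ℕ.m<n⇒m%n≡m (ℕ.≤-<-trans (ℕ.m∸n≤m j i) j<n))) (ℕ.n∣m⇒m%n≡0 (j ∸ i) n n∣j∸i)

    <-≈⇒≡ : ∀ {i j} → i ℕ.< n → j ℕ.< n → + i ≈ + j → i ≡ j
    <-≈⇒≡ {i} {j} i<n j<n i≈j with ℕ.≤-total i j
    ... | inj₁ i≤j = sym (≤-≈⇒≡ i≤j j<n (≈-sym i≈j))
    ... | inj₂ j≤i = ≤-≈⇒≡ j≤i i<n i≈j

    ≈⇒%≡ : ∀ {a b} → + a ≈ + b → a % n ≡ b % n
    ≈⇒%≡ {a} {b} a≈b = <-≈⇒≡ (ℕ.m%n<n a n) (ℕ.m%n<n b n)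
      (≈-trans (%-≈ a) (≈-trans a≈b (≈-sym (%-≈ b))))

  module _ (prime : Prime n) where

    ≈0-*⁻ : ∀ {a b} → a * b ≈ + 0 → a ≈ + 0 ⊎ b ≈ + 0
    ≈0-*⁻ {a} {b} ab≈0
      with euclidsLemma ∣ a ∣ ∣ b ∣ prime (subst (n ℕ.∣_) (ℤ.abs-* a b) (≈0⇒∣ ab≈0))
    ... | inj₁ n∣a = inj₁ (∣⇒≈0 n∣a)
    ... | inj₂ n∣b = inj₂ (∣⇒≈0 n∣b)

    ≉0-* : ∀ {a b} → ¬ a ≈ + 0 → ¬ b ≈ + 0 → ¬ a * b ≈ + 0
    ≉0-* a≉0 b≉0 ab≈0 with ≈0-*⁻ ab≈0
    ... | inj₁ a≈0 = a≉0 a≈0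
    ... | inj₂ b≈0 = b≉0 b≈0

    *-cancelˡ : ∀ {c a b} → ¬ c ≈ + 0 → c * a ≈ c * b → a ≈ b
    *-cancelˡ {c} {a} {b} c≉0 ca≈cb
      with ≈0-*⁻ (≈-trans (≈-reflexive (factor c a b)) (≈⇒-≈0 ca≈cb))
      where
      factor : ∀ c a b → c * (a - b) ≡ c * a - c * b
      factor = solve-∀
    ... | inj₁ c≈0   = ⊥-elim (c≉0 c≈0)
    ... | inj₂ a-b≈0 = -≈0⇒≈ a-b≈0

    *-cancelʳ : ∀ {c a b} → ¬ c ≈ + 0 → a * c ≈ b * c → a ≈ b
    *-cancelʳ {c} {a} {b} c≉0 ac≈bc = *-cancelˡ c≉0
      (≈-trans (≈-reflexive (ℤ.*-comm c a)) (≈-trans ac≈bc (≈-reflexive (ℤ.*-comm b c))))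

  ∏-≈-cong : ∀ {A : Set} {f g : A → ℤ} xs → (∀ {x} → x ∈ xs → f x ≈ g x) → ∏ f xs ≈ ∏ g xs
  ∏-≈-cong []       _   = ≈-refl
  ∏-≈-cong (x ∷ xs) f≈g = *-cong (f≈g (here refl)) (∏-≈-cong xs (λ x∈ → f≈g (there x∈)))

  record PairsUp (π : ℕ → ℕ) (xs : List ℕ) : Set where
    field
      closed      : ∀ {x} → x ∈ xs → π x ∈ xs
      no-fixpoint : ∀ {x} → x ∈ xs → π x ≢ x
      involutive  : ∀ {x} → x ∈ xs → π (π x) ≡ x

  module _ {π : ℕ → ℕ} {f : ℕ → ℤ} {c : ℤ} where

    private
      pair-off : ∀ fuel xs → length xs ℕ.≤ fuel → Unique xs → PairsUp π xs →
                 (∀ {x} → x ∈ xs → f x * f (π x) ≈ c) →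
                 ∃[ e ] length xs ≡ e ℕ.+ e × ∏ f xs ≈ c ^ e
      pair-off _          []       _   _          _     _     = 0 , refl , ≈-refl
      pair-off (suc fuel) (x ∷ ys) len (x∉ ∷ ys!) pairs f·fπ≈c
        with PairsUp.closed pairs (here refl)
      ... | here πx≡x = ⊥-elim (PairsUp.no-fixpoint pairs (here refl) πx≡x)
      ... | there πx∈ys with ∈-∃++ πx∈ys
      ... | as , bs , refl
        with πx∉ ∷ rest! ← unique-shift as ys!
        with pair-off fuel (as ++ bs) len′ rest! pairs′ (λ y∈ → f·fπ≈c (there (∈-insert as y∈)))
        where
        len′ : length (as ++ bs) ℕ.≤ fuel
        len′ = ℕ.≤-trans (ℕ.n≤1+n _) (ℕ.≤-trans (ℕ.≤-reflexive (sym (↭-length (shift (π x) as bs)))) (ℕ.≤-pred len))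
        inner : ∀ {y} → y ∈ as ++ bs → y ∈ x ∷ as ++ π x ∷ bs
        inner y∈ = there (∈-insert as y∈)
        closed′ : ∀ {y} → y ∈ as ++ bs → π y ∈ as ++ bs
        closed′ {y} y∈ with PairsUp.closed pairs (inner y∈)
        ... | here πy≡x = ⊥-elim (All.lookup πx∉ y∈ (trans (sym (cong π πy≡x)) (PairsUp.involutive pairs (inner y∈))))
        ... | there πy∈ = ∈-delete as πy∈ (λ πy≡πx → All.lookup x∉ (∈-insert as y∈)
                            (sym (trans (sym (PairsUp.involutive pairs (inner y∈)))
                              (trans (cong π πy≡πx) (PairsUp.involutive pairs (here refl))))))
        pairs′ : PairsUp π (as ++ bs)
        pairs′ = record
          { closed      = closed′
          ; no-fixpoint = λ y∈ → PairsUp.no-fixpoint pairs (inner y∈)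
          ; involutive  = λ y∈ → PairsUp.involutive pairs (inner y∈)
          }
      ... | e , len≡e+e , ∏≈c^e = suc e , length≡ , ∏≈
        where
        length≡ : length (x ∷ as ++ π x ∷ bs) ≡ suc e ℕ.+ suc e
        length≡ = cong suc (trans (↭-length (shift (π x) as bs)) (trans (cong suc len≡e+e) (sym (ℕ.+-suc e e))))
        ∏≈ : ∏ f (x ∷ as ++ π x ∷ bs) ≈ c ^ suc e
        ∏≈ = ≈-trans (≈-reflexive (trans (cong (f x *_) (∏-↭ f (shift (π x) as bs)))
                                         (sym (ℤ.*-assoc (f x) (f (π x)) (∏ f (as ++ bs))))))
                     (*-cong (f·fπ≈c (here refl)) ∏≈c^e)

    involution-pairing : ∀ xs → Unique xs → PairsUp π xs → (∀ {x} → x ∈ xs → f x * f (π x) ≈ c) →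
                         ∃[ e ] length xs ≡ e ℕ.+ e × ∏ f xs ≈ c ^ e
    involution-pairing xs = pair-off (length xs) xs ℕ.≤-refl

module Signs where

  open import Data.Nat as ℕ using (ℕ; zero; suc; _%_; _/_; ⌊_/2⌋; NonZero)
  import Data.Nat.Properties as ℕ
  import Data.Nat.DivMod as ℕ
  open import Data.Nat.Divisibility using (_∣_; divides; m%n≡0⇒n∣m; n∣m⇒m%n≡0)
  open import Data.Nat.ListAction using (product)
  open import Data.Nat.Tactic.RingSolver using (solve-∀)
  open import Data.Integer as ℤ using (ℤ; _*_; _^_; 1ℤ; -1ℤ)
  import Data.Integer.Properties as ℤ
  open import Data.List using ([]; _∷_)
  open import Data.List.Relation.Unary.All using (All; []; _∷_)
  open import Data.Product using (∃-syntax; _,_)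
  open import Data.Sum using (_⊎_; inj₁; inj₂)
  open import Data.Empty using (⊥-elim)
  open import Relation.Binary.PropositionalEquality
  open import Relation.Nullary using (¬_)
  open BigOperators using (∑; ∏; ∏-cong)

  IsSign : ℤ → Set
  IsSign a = a ≡ 1ℤ ⊎ a ≡ -1ℤ

  IsSign-* : ∀ {a b} → IsSign a → IsSign b → IsSign (a * b)
  IsSign-* (inj₁ refl) (inj₁ refl) = inj₁ refl
  IsSign-* (inj₁ refl) (inj₂ refl) = inj₂ refl
  IsSign-* (inj₂ refl) (inj₁ refl) = inj₂ refl
  IsSign-* (inj₂ refl) (inj₂ refl) = inj₁ refl

  IsSign⇒*-self : ∀ {a} → IsSign a → a * a ≡ 1ℤ
  IsSign⇒*-self (inj₁ refl) = refl
  IsSign⇒*-self (inj₂ refl) = refl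

  IsSign-∏ : ∀ {P : ℕ → Set} (f : ℕ → ℤ) xs → All P xs → (∀ {x} → P x → IsSign (f x)) → IsSign (∏ f xs)
  IsSign-∏ f []       _          _    = inj₁ refl
  IsSign-∏ f (x ∷ xs) (px ∷ pxs) sign = IsSign-* (sign px) (IsSign-∏ f xs pxs sign)

  -1^-isSign : ∀ n → IsSign (-1ℤ ^ n)
  -1^-isSign zero    = inj₁ refl
  -1^-isSign (suc n) with -1^-isSign n
  ... | inj₁ eq = inj₂ (cong (-1ℤ *_) eq)
  ... | inj₂ eq = inj₁ (cong (-1ℤ *_) eq)

  -1^-even : ∀ m → -1ℤ ^ (2 ℕ.* m) ≡ 1ℤ
  -1^-even m = begin
    -1ℤ ^ (2 ℕ.* m)    ≡⟨ ℤ.^-*-assoc -1ℤ 2 m ⟨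
    (-1ℤ ^ 2) ^ m      ≡⟨ ℤ.^-zeroˡ m ⟩
    1ℤ                 ∎
    where open ≡-Reasoning

  -1^-+-even : ∀ m k → -1ℤ ^ (m ℕ.+ 2 ℕ.* k) ≡ -1ℤ ^ m
  -1^-+-even m k = begin
    -1ℤ ^ (m ℕ.+ 2 ℕ.* k)          ≡⟨ ℤ.^-distribˡ-+-* -1ℤ m (2 ℕ.* k) ⟩
    -1ℤ ^ m * -1ℤ ^ (2 ℕ.* k)      ≡⟨ cong (-1ℤ ^ m *_) (-1^-even k) ⟩
    -1ℤ ^ m * 1ℤ                   ≡⟨ ℤ.*-identityʳ (-1ℤ ^ m) ⟩
    -1ℤ ^ m                        ∎
    where open ≡-Reasoning

  -1^-*-self : ∀ n → -1ℤ ^ n * -1ℤ ^ n ≡ 1ℤ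
  -1^-*-self n = IsSign⇒*-self (-1^-isSign n)

  ∏-[-1]^ : ∀ {A : Set} (f : A → ℕ) xs → ∏ (λ x → -1ℤ ^ f x) xs ≡ -1ℤ ^ ∑ f xs
  ∏-[-1]^ f []       = refl
  ∏-[-1]^ f (x ∷ xs) = trans (cong (-1ℤ ^ f x *_) (∏-[-1]^ f xs)) (sym (ℤ.^-distribˡ-+-* -1ℤ (f x) (∑ f xs)))

  -1^-cong-parity : ∀ {m n} → 2 ∣ m ℕ.+ n → -1ℤ ^ m ≡ -1ℤ ^ n
  -1^-cong-parity {m} {n} (divides t m+n≡t*2) = begin
    -1ℤ ^ m                                ≡⟨ ℤ.*-identityʳ (-1ℤ ^ m) ⟨
    -1ℤ ^ m * 1ℤ                           ≡⟨ cong (-1ℤ ^ m *_) (-1^-*-self n) ⟨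
    -1ℤ ^ m * (-1ℤ ^ n * -1ℤ ^ n)          ≡⟨ ℤ.*-assoc (-1ℤ ^ m) (-1ℤ ^ n) (-1ℤ ^ n) ⟨
    -1ℤ ^ m * -1ℤ ^ n * -1ℤ ^ n            ≡⟨ cong (_* -1ℤ ^ n) (ℤ.^-distribˡ-+-* -1ℤ m n) ⟨
    -1ℤ ^ (m ℕ.+ n) * -1ℤ ^ n              ≡⟨ cong (λ e → -1ℤ ^ e * -1ℤ ^ n) (trans m+n≡t*2 (ℕ.*-comm t 2)) ⟩
    -1ℤ ^ (2 ℕ.* t) * -1ℤ ^ n              ≡⟨ cong (_* -1ℤ ^ n) (-1^-even t) ⟩
    1ℤ * -1ℤ ^ n                           ≡⟨ ℤ.*-identityˡ (-1ℤ ^ n) ⟩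
    -1ℤ ^ n                                ∎
    where open ≡-Reasoning

  Odd : ℕ → Set
  Odd n = ∃[ t ] n ≡ suc (2 ℕ.* t)

  Odd⇒NonZero : ∀ {n} → Odd n → NonZero n
  Odd⇒NonZero (_ , refl) = _

  Odd-* : ∀ {a b} → Odd a → Odd b → Odd (a ℕ.* b)
  Odd-* (s , refl) (t , refl) = 2 ℕ.* s ℕ.* t ℕ.+ s ℕ.+ t , odd-*-odd s t
    where
    odd-*-odd : ∀ s t → suc (2 ℕ.* s) ℕ.* suc (2 ℕ.* t) ≡ suc (2 ℕ.* (2 ℕ.* s ℕ.* t ℕ.+ s ℕ.+ t))
    odd-*-odd = solve-∀

  Odd-product : ∀ ps → All Odd ps → Odd (product ps)
  Odd-product []       []         = 0 , refl
  Odd-product (p ∷ ps) (op ∷ ops) = Odd-* op (Odd-product ps ops)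

  Odd⇒%2≡1 : ∀ {n} → Odd n → n % 2 ≡ 1
  Odd⇒%2≡1 (t , refl) = trans (cong (_% 2) (ℕ.+-comm 1 (2 ℕ.* t))) (trans (cong (λ z → (z ℕ.+ 1) % 2) (ℕ.*-comm 2 t))
    (trans (cong (_% 2) (ℕ.+-comm (t ℕ.* 2) 1)) (ℕ.[m+kn]%n≡m%n 1 t 2)))

  %2≡1⇒Odd : ∀ {n} → n % 2 ≡ 1 → Odd n
  %2≡1⇒Odd {n} n%2≡1 = n / 2 , (begin
    n                      ≡⟨ ℕ.m≡m%n+[m/n]*n n 2 ⟩
    n % 2 ℕ.+ n / 2 ℕ.* 2  ≡⟨ cong₂ ℕ._+_ n%2≡1 (ℕ.*-comm (n / 2) 2) ⟩
    suc (2 ℕ.* (n / 2))    ∎)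
    where open ≡-Reasoning

  Odd⇒¬2∣ : ∀ {n} → Odd n → ¬ (2 ∣ n)
  Odd⇒¬2∣ {n} on 2∣n = ℕ.0≢1+n (trans (sym (n∣m⇒m%n≡0 n 2 2∣n)) (Odd⇒%2≡1 on))

  ¬2∣⇒Odd : ∀ {n} → ¬ (2 ∣ n) → Odd n
  ¬2∣⇒Odd {n} 2∤n with n % 2 in eq | ℕ.m%n<n n 2
  ... | 0 | _ = ⊥-elim (2∤n (m%n≡0⇒n∣m n 2 eq))
  ... | 1 | _ = %2≡1⇒Odd eq
  ... | suc (suc _) | ℕ.s≤s (ℕ.s≤s ())

  ⌊odd/2⌋ : ∀ t → ⌊ suc (2 ℕ.* t) /2⌋ ≡ t
  ⌊odd/2⌋ zero    = refl
  ⌊odd/2⌋ (suc t) = cong suc (trans (cong ⌊_/2⌋ (ℕ.+-suc t (t ℕ.+ 0))) (⌊odd/2⌋ t))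

  ⌊n+4k/2⌋ : ∀ n k → ⌊ n ℕ.+ k ℕ.* 4 /2⌋ ≡ ⌊ n /2⌋ ℕ.+ 2 ℕ.* k
  ⌊n+4k/2⌋ n zero    = trans (cong ⌊_/2⌋ (ℕ.+-identityʳ n)) (sym (ℕ.+-identityʳ ⌊ n /2⌋))
  ⌊n+4k/2⌋ n (suc k) = begin
    ⌊ n ℕ.+ suc k ℕ.* 4 /2⌋             ≡⟨ cong ⌊_/2⌋ (shift n k) ⟩
    suc (suc ⌊ n ℕ.+ k ℕ.* 4 /2⌋)       ≡⟨ cong (λ z → suc (suc z)) (⌊n+4k/2⌋ n k) ⟩
    suc (suc (⌊ n /2⌋ ℕ.+ 2 ℕ.* k))     ≡⟨ regroup ⌊ n /2⌋ k ⟩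
    ⌊ n /2⌋ ℕ.+ 2 ℕ.* suc k             ∎
    where
    open ≡-Reasoning
    shift : ∀ n k → n ℕ.+ suc k ℕ.* 4 ≡ 4 ℕ.+ (n ℕ.+ k ℕ.* 4)
    shift = solve-∀
    regroup : ∀ h k → suc (suc (h ℕ.+ 2 ℕ.* k)) ≡ h ℕ.+ 2 ℕ.* suc k
    regroup = solve-∀

  ⌊n/2⌋≡⌊n%4/2⌋+2[n/4] : ∀ n → ⌊ n /2⌋ ≡ ⌊ n % 4 /2⌋ ℕ.+ 2 ℕ.* (n / 4)
  ⌊n/2⌋≡⌊n%4/2⌋+2[n/4] n = trans (cong ⌊_/2⌋ (ℕ.m≡m%n+[m/n]*n n 4)) (⌊n+4k/2⌋ (n % 4) (n / 4))

  χ : ℕ → ℤ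
  χ n = -1ℤ ^ ⌊ n /2⌋

  ε : ℕ → ℕ → ℤ
  ε a b = -1ℤ ^ (⌊ a /2⌋ ℕ.* ⌊ b /2⌋)

  ε-comm : ∀ a b → ε a b ≡ ε b a
  ε-comm a b = cong (-1ℤ ^_) (ℕ.*-comm ⌊ a /2⌋ ⌊ b /2⌋)

  ε-multˡ : ∀ {a a′} b → Odd a → Odd a′ → ε (a ℕ.* a′) b ≡ ε a b ℤ.* ε a′ b
  ε-multˡ {a} {a′} b (s , refl) (t , refl) = begin
    -1ℤ ^ (⌊ suc (2 ℕ.* s) ℕ.* suc (2 ℕ.* t) /2⌋ ℕ.* ⌊ b /2⌋)
      ≡⟨ cong (λ z → -1ℤ ^ (⌊ z /2⌋ ℕ.* ⌊ b /2⌋)) (odd-*-odd s t) ⟩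
    -1ℤ ^ (⌊ suc (2 ℕ.* (2 ℕ.* s ℕ.* t ℕ.+ s ℕ.+ t)) /2⌋ ℕ.* ⌊ b /2⌋)
      ≡⟨ cong (λ z → -1ℤ ^ (z ℕ.* ⌊ b /2⌋)) (⌊odd/2⌋ (2 ℕ.* s ℕ.* t ℕ.+ s ℕ.+ t)) ⟩
    -1ℤ ^ ((2 ℕ.* s ℕ.* t ℕ.+ s ℕ.+ t) ℕ.* ⌊ b /2⌋)
      ≡⟨ cong (-1ℤ ^_) (expand s t ⌊ b /2⌋) ⟩
    -1ℤ ^ (s ℕ.* ⌊ b /2⌋ ℕ.+ t ℕ.* ⌊ b /2⌋ ℕ.+ 2 ℕ.* (s ℕ.* t ℕ.* ⌊ b /2⌋))
      ≡⟨ -1^-+-even (s ℕ.* ⌊ b /2⌋ ℕ.+ t ℕ.* ⌊ b /2⌋) (s ℕ.* t ℕ.* ⌊ b /2⌋) ⟩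
    -1ℤ ^ (s ℕ.* ⌊ b /2⌋ ℕ.+ t ℕ.* ⌊ b /2⌋)
      ≡⟨ ℤ.^-distribˡ-+-* -1ℤ (s ℕ.* ⌊ b /2⌋) (t ℕ.* ⌊ b /2⌋) ⟩
    -1ℤ ^ (s ℕ.* ⌊ b /2⌋) ℤ.* -1ℤ ^ (t ℕ.* ⌊ b /2⌋)
      ≡⟨ cong₂ (λ x y → -1ℤ ^ (x ℕ.* ⌊ b /2⌋) ℤ.* -1ℤ ^ (y ℕ.* ⌊ b /2⌋)) (⌊odd/2⌋ s) (⌊odd/2⌋ t) ⟨
    ε (suc (2 ℕ.* s)) b ℤ.* ε (suc (2 ℕ.* t)) b ∎
    where
    open ≡-Reasoning
    odd-*-odd : ∀ s t → suc (2 ℕ.* s) ℕ.* suc (2 ℕ.* t) ≡ suc (2 ℕ.* (2 ℕ.* s ℕ.* t ℕ.+ s ℕ.+ t))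
    odd-*-odd = solve-∀
    expand : ∀ s t u → (2 ℕ.* s ℕ.* t ℕ.+ s ℕ.+ t) ℕ.* u ≡ s ℕ.* u ℕ.+ t ℕ.* u ℕ.+ 2 ℕ.* (s ℕ.* t ℕ.* u)
    expand = solve-∀

  ε-multʳ : ∀ a {b b′} → Odd b → Odd b′ → ε a (b ℕ.* b′) ≡ ε a b ℤ.* ε a b′
  ε-multʳ a {b} {b′} ob ob′ =
    trans (ε-comm a (b ℕ.* b′)) (trans (ε-multˡ a ob ob′) (cong₂ ℤ._*_ (ε-comm b a) (ε-comm b′ a)))

  ε-productʳ : ∀ a qs → All Odd qs → ∏ (ε a) qs ≡ ε a (product qs)
  ε-productʳ a []       []         = cong (-1ℤ ^_) (sym (ℕ.*-zeroʳ ⌊ a /2⌋))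
  ε-productʳ a (q ∷ qs) (oq ∷ oqs) =
    trans (cong (ε a q ℤ.*_) (ε-productʳ a qs oqs)) (sym (ε-multʳ a oq (Odd-product qs oqs)))

  ε-productˡ : ∀ ps b → All Odd ps → ∏ (λ p → ε p b) ps ≡ ε (product ps) b
  ε-productˡ ps b ops =
    trans (∏-cong ps (λ {p} _ → ε-comm p b)) (trans (ε-productʳ b ps ops) (ε-comm b (product ps)))

  χ≡ε3 : ∀ n → χ n ≡ ε n 3
  χ≡ε3 n = cong (-1ℤ ^_) (sym (ℕ.*-identityʳ ⌊ n /2⌋))

  χ-mult : ∀ {a b} → Odd a → Odd b → χ (a ℕ.* b) ≡ χ a ℤ.* χ b
  χ-mult {a} {b} oa ob = begin
    χ (a ℕ.* b)           ≡⟨ χ≡ε3 (a ℕ.* b) ⟩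
    ε (a ℕ.* b) 3         ≡⟨ ε-multˡ 3 oa ob ⟩
    ε a 3 ℤ.* ε b 3       ≡⟨ cong₂ ℤ._*_ (χ≡ε3 a) (χ≡ε3 b) ⟨
    χ a ℤ.* χ b           ∎
    where open ≡-Reasoning

  χ-product : ∀ ps → All Odd ps → ∏ χ ps ≡ χ (product ps)
  χ-product []       []         = refl
  χ-product (p ∷ ps) (op ∷ ops) =
    trans (cong (χ p ℤ.*_) (χ-product ps ops)) (sym (χ-mult op (Odd-product ps ops)))

  χ-%4 : ∀ n → χ n ≡ χ (n % 4)
  χ-%4 n = trans (cong (-1ℤ ^_) (⌊n/2⌋≡⌊n%4/2⌋+2[n/4] n)) (-1^-+-even ⌊ n % 4 /2⌋ (n / 4))

  ε-%4 : ∀ a b → ε a b ≡ ε (a % 4) (b % 4)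
  ε-%4 a b = begin
    -1ℤ ^ (⌊ a /2⌋ ℕ.* ⌊ b /2⌋)
      ≡⟨ cong (-1ℤ ^_) (cong₂ ℕ._*_ (⌊n/2⌋≡⌊n%4/2⌋+2[n/4] a) (⌊n/2⌋≡⌊n%4/2⌋+2[n/4] b)) ⟩
    -1ℤ ^ ((x ℕ.+ 2 ℕ.* u) ℕ.* (y ℕ.+ 2 ℕ.* v))
      ≡⟨ cong (-1ℤ ^_) (expand x u y v) ⟩
    -1ℤ ^ (x ℕ.* y ℕ.+ 2 ℕ.* (u ℕ.* y ℕ.+ x ℕ.* v ℕ.+ 2 ℕ.* u ℕ.* v))
      ≡⟨ -1^-+-even (x ℕ.* y) (u ℕ.* y ℕ.+ x ℕ.* v ℕ.+ 2 ℕ.* u ℕ.* v) ⟩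
    -1ℤ ^ (x ℕ.* y) ∎
    where
    open ≡-Reasoning
    x = ⌊ a % 4 /2⌋
    y = ⌊ b % 4 /2⌋
    u = a / 4
    v = b / 4
    expand : ∀ x u y v → (x ℕ.+ 2 ℕ.* u) ℕ.* (y ℕ.+ 2 ℕ.* v) ≡ x ℕ.* y ℕ.+ 2 ℕ.* (u ℕ.* y ℕ.+ x ℕ.* v ℕ.+ 2 ℕ.* u ℕ.* v)
    expand = solve-∀

module Legendre where

  open import Data.Nat using (ℕ; zero; suc; _<_; _*_; _%_; _≡ᵇ_; NonZero)
  import Data.Nat.Properties as ℕ
  open import Data.Bool using (Bool; true; false; T; if_then_else_)
  open import Data.Bool.ListAction using (any)
  open import Data.Integer using (0ℤ; 1ℤ; -1ℤ)
  open import Data.List using (upTo)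
  open import Data.List.Membership.Propositional using (find; lose)
  open import Data.List.Membership.Propositional.Properties using (∈-upTo⁺; ∈-upTo⁻)
  open import Data.List.Relation.Unary.Any.Properties using (any⁺; any⁻)
  open import Data.Product using (∃-syntax; _×_; _,_)
  open import Data.Empty using (⊥-elim)
  open import Relation.Binary.PropositionalEquality
  open import Relation.Nullary using (¬_; Dec; yes; no)
  open import Defs using (legendre)

  IsSquareMod : (P : ℕ) .{{_ : NonZero P}} → ℕ → Set
  IsSquareMod P m = ∃[ x ] x < P × (x * x) % P ≡ m % P

  module _ (m : ℕ) (k : ℕ) where

    private
      P = suc k
      isRoot : ℕ → Bool
      isRoot x = (x * x) % P ≡ᵇ m % P

      T-any⇒square : T (any isRoot (upTo P)) → IsSquareMod P m
      T-any⇒square t with find (any⁻ isRoot (upTo P) t)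
      ... | x , x∈ , root = x , ∈-upTo⁻ x∈ , ℕ.≡ᵇ⇒≡ _ _ root

      square⇒T-any : IsSquareMod P m → T (any isRoot (upTo P))
      square⇒T-any (x , x<P , eq) = any⁺ isRoot (lose (∈-upTo⁺ x<P) (ℕ.≡⇒≡ᵇ _ _ eq))

      legendre-≢0 : m % P ≢ 0 → legendre m P ≡ (if any isRoot (upTo P) then 1ℤ else -1ℤ)
      legendre-≢0 m%P≢0 = cong (λ b → if b then 0ℤ else if any isRoot (upTo P) then 1ℤ else -1ℤ) (≢0⇒≡ᵇ0-false m%P≢0)
        where
        ≢0⇒≡ᵇ0-false : ∀ {n} → n ≢ 0 → (n ≡ᵇ 0) ≡ false
        ≢0⇒≡ᵇ0-false {zero}  n≢0 = ⊥-elim (n≢0 refl)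
        ≢0⇒≡ᵇ0-false {suc _} _   = refl

    isSquareMod? : Dec (IsSquareMod (suc k) m)
    isSquareMod? with any isRoot (upTo P) in eq
    ... | true  = yes (T-any⇒square (subst T (sym eq) _))
    ... | false = no (λ sq → subst T eq (square⇒T-any sq))

    legendre-≡0 : m % suc k ≡ 0 → legendre m (suc k) ≡ 0ℤ
    legendre-≡0 eq rewrite eq = refl

    legendre-square : m % suc k ≢ 0 → IsSquareMod (suc k) m → legendre m (suc k) ≡ 1ℤ
    legendre-square m%P≢0 sq with any isRoot (upTo P) in eq | legendre-≢0 m%P≢0
    ... | true  | leg = leg
    ... | false | _   = ⊥-elim (subst T eq (square⇒T-any sq))

    legendre-nonsquare : m % suc k ≢ 0 → ¬ IsSquareMod (suc k) m → legendre m (suc k) ≡ -1ℤ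
    legendre-nonsquare m%P≢0 ¬sq with any isRoot (upTo P) in eq | legendre-≢0 m%P≢0
    ... | true  | _   = ⊥-elim (¬sq (T-any⇒square (subst T (sym eq) _)))
    ... | false | leg = leg

  legendre-% : ∀ a b k → a % suc k ≡ b % suc k → legendre a (suc k) ≡ legendre b (suc k)
  legendre-% a b k eq =
    cong (λ r → if r ≡ᵇ 0 then 0ℤ else if any (λ x → (x * x) % suc k ≡ᵇ r) (upTo (suc k)) then 1ℤ else -1ℤ) eq

module QuadraticResidues (h : ℕ) (prime : Prime (suc (2 ℕ.* h))) where

  open import Data.Nat as ℕ using (zero; suc; _*_; _≤_; _<_; s≤s; z≤n; _%_; _∸_; _<?_; ⌊_/2⌋)
  import Data.Nat.Properties as ℕ
  import Data.Nat.DivMod as ℕ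
  open import Data.Nat.Primality using (prime⇒nonTrivial)
  open import Data.Integer as ℤ using (ℤ; +_; _+_; _-_; -_; _^_; 0ℤ; 1ℤ; -1ℤ)
  import Data.Integer.Properties as ℤ
  open import Data.Integer.Tactic.RingSolver using (solve-∀)
  open import Data.List using (List; map; length)
  open import Data.List.Membership.Propositional using (_∈_)
  open import Data.List.Membership.Propositional.Properties using (∈-map⁻; ∈-map⁺)
  open import Data.List.Relation.Binary.Permutation.Propositional using (_↭_)
  open import Data.List.Relation.Unary.Unique.Propositional using (Unique)
  open import Data.Product using (∃-syntax; _×_; _,_; proj₁; proj₂)
  open import Data.Sum using (_⊎_; inj₁; inj₂)
  open import Data.Empty using (⊥-elim)
  open import Relation.Binary.PropositionalEquality
  open import Relation.Nullary using (¬_; yes; no)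
  open import Defs using (legendre)
  open BigOperators
  open Signs
  open Legendre
  open Congruence (suc (2 * h))
  open import Relation.Binary.Reasoning.Setoid ≈-setoid

  p : ℕ
  p = suc (2 * h)

  1<p : 1 < p
  1<p = ℕ.nonTrivial⇒n>1 p {{prime⇒nonTrivial prime}}

  h<p : h < p
  h<p = s≤s (ℕ.m≤m+n h (h ℕ.+ 0))

  0<j<p⇒≉0 : ∀ {j} → 1 ≤ j → j < p → ¬ + j ≈ 0ℤ
  0<j<p⇒≉0 {suc j} _ j<p j≈0 = ℕ.<⇒≱ j<p (≈0-≤ _ j≈0)

  ∈-range-≉0 : ∀ {n j} → n < p → j ∈ range n → ¬ + j ≈ 0ℤ
  ∈-range-≉0 n<p j∈ = 0<j<p⇒≉0 (proj₁ (∈-range⁻ j∈)) (ℕ.≤-<-trans (proj₂ (∈-range⁻ j∈)) n<p)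

  ∏-range-≉0 : ∀ n → n < p → ¬ ∏ +_ (range n) ≈ 0ℤ
  ∏-range-≉0 zero    _   = 0<j<p⇒≉0 (s≤s z≤n) 1<p
  ∏-range-≉0 (suc n) n<p = ≉0-* prime (0<j<p⇒≉0 (s≤s z≤n) n<p) (∏-range-≉0 n (ℕ.<-trans (ℕ.n<1+n n) n<p))

  module GaussLemma (q : ℕ) (q≉0 : ¬ + q ≈ 0ℤ) where

    residue : ℕ → ℕ
    residue j = (q * j) % p

    residue≈ : ∀ j → + residue j ≈ + q ℤ.* + j
    residue≈ j = ≈-trans (%-≈ (q * j)) (≈-reflexive (ℤ.pos-* q j))

    residue<p : ∀ j → residue j < p
    residue<p j = ℕ.m%n<n (q * j) p

    residue≢0 : ∀ {j} → j ∈ range h → residue j ≢ 0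
    residue≢0 {j} j∈ r≡0 with ≈0-*⁻ prime (≈-trans (≈-sym (residue≈ j)) (≈-reflexive (cong +_ r≡0)))
    ... | inj₁ q≈0 = q≉0 q≈0
    ... | inj₂ j≈0 = ∈-range-≉0 h<p j∈ j≈0

    -- the absolute least residue of q j is ± folded j, with sign (-1)^(overflow j)
    folded : ℕ → ℕ
    folded j with h <? residue j
    ... | yes _ = p ∸ residue j
    ... | no  _ = residue j

    overflow : ℕ → ℕ
    overflow j with h <? residue j
    ... | yes _ = 1
    ... | no  _ = 0

    μ : ℕ
    μ = ∑ overflow (range h)

    residue-injective : ∀ {i j} → i ∈ range h → j ∈ range h → residue i ≡ residue j → i ≡ j
    residue-injective {i} {j} i∈ j∈ eq =
      <-≈⇒≡ (ℕ.≤-<-trans (proj₂ (∈-range⁻ i∈)) h<p) (ℕ.≤-<-trans (proj₂ (∈-range⁻ j∈)) h<p)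
        (*-cancelˡ prime q≉0 (≈-trans (≈-sym (residue≈ i)) (≈-trans (≈-reflexive (cong +_ eq)) (residue≈ j))))

    residue+residue≢p : ∀ {i j} → i ∈ range h → j ∈ range h → residue i ℕ.+ residue j ≢ p
    residue+residue≢p {i} {j} i∈ j∈ eq with ≈0-*⁻ prime q[i+j]≈0
      where
      q[i+j]≈0 : + q ℤ.* (+ i + + j) ≈ 0ℤ
      q[i+j]≈0 = begin
        + q ℤ.* (+ i + + j)             ≡⟨ ℤ.*-distribˡ-+ (+ q) (+ i) (+ j) ⟩
        + q ℤ.* + i + + q ℤ.* + j       ≈⟨ +-cong (residue≈ i) (residue≈ j) ⟨
        + residue i + + residue j       ≡⟨ trans (sym (ℤ.pos-+ (residue i) (residue j))) (cong +_ eq) ⟩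
        + p                             ≈⟨ n≈0 ⟩
        0ℤ                              ∎
    ... | inj₁ q≈0   = q≉0 q≈0
    ... | inj₂ i+j≈0 = ∈-range-≉0 {h ℕ.+ h} 2h<p (∈-range⁺ i+j≥1 i+j≤2h) (≈-trans (≈-reflexive (ℤ.pos-+ i j)) i+j≈0)
      where
      2h<p : h ℕ.+ h < p
      2h<p = s≤s (ℕ.≤-reflexive (cong (h ℕ.+_) (sym (ℕ.+-identityʳ h))))
      i+j≥1 : 1 ≤ i ℕ.+ j
      i+j≥1 = ℕ.≤-trans (proj₁ (∈-range⁻ i∈)) (ℕ.m≤m+n i j)
      i+j≤2h : i ℕ.+ j ≤ h ℕ.+ h
      i+j≤2h = ℕ.+-mono-≤ (proj₂ (∈-range⁻ i∈)) (proj₂ (∈-range⁻ j∈))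

    folded∈range : ∀ {j} → j ∈ range h → folded j ∈ range h
    folded∈range {j} j∈ with h <? residue j
    ... | yes h<r = ∈-range⁺ (ℕ.m<n⇒0<n∸m (residue<p j)) (ℕ.≤-trans (ℕ.∸-monoʳ-≤ p h<r) (ℕ.≤-reflexive p∸[1+h]≡h))
      where
      p∸[1+h]≡h : p ∸ suc h ≡ h
      p∸[1+h]≡h = trans (ℕ.m+n∸m≡n h (h ℕ.+ 0)) (ℕ.+-identityʳ h)
    ... | no  h≮r = ∈-range⁺ (ℕ.n≢0⇒n>0 (residue≢0 j∈)) (ℕ.≮⇒≥ h≮r)

    folded-injective : ∀ {i j} → i ∈ range h → j ∈ range h → folded i ≡ folded j → i ≡ j
    folded-injective {i} {j} i∈ j∈ eq with h <? residue i | h <? residue j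
    ... | yes _ | yes _ = residue-injective i∈ j∈ (ℕ.∸-cancelˡ-≡ (ℕ.<⇒≤ (residue<p i)) (ℕ.<⇒≤ (residue<p j)) eq)
    ... | no  _ | no  _ = residue-injective i∈ j∈ eq
    ... | yes _ | no  _ = ⊥-elim (residue+residue≢p i∈ j∈ (trans (cong (residue i ℕ.+_) (sym eq)) (ℕ.m+[n∸m]≡n (ℕ.<⇒≤ (residue<p i)))))
    ... | no  _ | yes _ = ⊥-elim (residue+residue≢p j∈ i∈ (trans (cong (residue j ℕ.+_) eq) (ℕ.m+[n∸m]≡n (ℕ.<⇒≤ (residue<p j)))))

    folded-↭ : map folded (range h) ↭ range h
    folded-↭ = injective⇒map-↭ folded (range h) (range-unique h) folded∈range folded-injective

    q*j≈±folded : ∀ j → + q ℤ.* + j ≈ -1ℤ ^ overflow j ℤ.* + folded j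
    q*j≈±folded j with h <? residue j
    ... | no  _ = ≈-trans (≈-sym (residue≈ j)) (≈-reflexive (sym (ℤ.*-identityˡ (+ residue j))))
    ... | yes _ = ≈-sym (begin
      -1ℤ ℤ.* + (p ∸ residue j)   ≡⟨ cong (-1ℤ ℤ.*_) (trans (sym (ℤ.⊖-≥ (ℕ.<⇒≤ (residue<p j)))) (sym (ℤ.m-n≡m⊖n p (residue j)))) ⟩
      -1ℤ ℤ.* (+ p - + residue j) ≡⟨ negate (+ p) (+ residue j) ⟩
      + residue j - + p           ≈⟨ +-cong (≈-refl {+ residue j}) (-‿cong n≈0) ⟩
      + residue j - 0ℤ            ≡⟨ ℤ.+-identityʳ (+ residue j) ⟩
      + residue j                 ≈⟨ residue≈ j ⟩
      + q ℤ.* + j                 ∎)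
      where
      negate : ∀ x y → -1ℤ ℤ.* (x - y) ≡ y - x
      negate = solve-∀

    ∏-q*j : ∀ n → ∏ (λ j → + q ℤ.* + j) (range n) ≡ (+ q) ^ n ℤ.* ∏ +_ (range n)
    ∏-q*j zero    = refl
    ∏-q*j (suc n) = trans (cong (+ q ℤ.* + suc n ℤ.*_) (∏-q*j n)) (interchange (+ q) (+ suc n) ((+ q) ^ n) (∏ +_ (range n)))
      where
      interchange : ∀ a b c d → a ℤ.* b ℤ.* (c ℤ.* d) ≡ a ℤ.* c ℤ.* (b ℤ.* d)
      interchange = solve-∀

    gauss : (+ q) ^ h ≈ -1ℤ ^ μ
    gauss = *-cancelʳ prime (∏-range-≉0 h h<p) (begin
      (+ q) ^ h ℤ.* ∏ +_ (range h)                                     ≡⟨ ∏-q*j h ⟨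
      ∏ (λ j → + q ℤ.* + j) (range h)                                ≈⟨ ∏-≈-cong (range h) (λ {j} _ → q*j≈±folded j) ⟩
      ∏ (λ j → -1ℤ ^ overflow j ℤ.* + folded j) (range h)            ≡⟨ ∏-* (λ j → -1ℤ ^ overflow j) (λ j → + folded j) (range h) ⟩
      ∏ (λ j → -1ℤ ^ overflow j) (range h) ℤ.* ∏ (λ j → + folded j) (range h)
                                                                     ≡⟨ cong₂ ℤ._*_ (∏-[-1]^ overflow (range h)) ∏-folded ⟩
      -1ℤ ^ μ ℤ.* ∏ +_ (range h)                                     ∎)
      where
      ∏-folded : ∏ (λ j → + folded j) (range h) ≡ ∏ +_ (range h)
      ∏-folded = trans (sym (∏-map +_ folded (range h))) (∏-↭ +_ folded-↭)

  fermat : ∀ x → ¬ + x ≈ 0ℤ → (+ x) ^ (2 * h) ≈ 1ℤ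
  fermat x x≉0 = begin
    (+ x) ^ (2 * h)             ≡⟨ cong ((+ x) ^_) 2h≡h+h ⟩
    (+ x) ^ (h ℕ.+ h)           ≡⟨ ℤ.^-distribˡ-+-* (+ x) h h ⟩
    (+ x) ^ h ℤ.* (+ x) ^ h     ≈⟨ *-cong gauss gauss ⟩
    -1ℤ ^ μ ℤ.* -1ℤ ^ μ         ≡⟨ -1^-*-self μ ⟩
    1ℤ                          ∎
    where
    open GaussLemma x x≉0
    2h≡h+h : 2 * h ≡ h ℕ.+ h
    2h≡h+h = cong (h ℕ.+_) (ℕ.+-identityʳ h)

  1≤h : 1 ≤ h
  1≤h = positive h 1<p
    where
    positive : ∀ h → 1 < suc (2 * h) → 1 ≤ h
    positive zero    (s≤s ())
    positive (suc _) _ = s≤s z≤n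

  2h≈-1 : + (2 * h) ≈ -1ℤ
  2h≈-1 = -≈0⇒≈ (≈-trans (≈-reflexive (trans (x+1 (+ (2 * h))) (sym (ℤ.pos-+ 1 (2 * h))))) n≈0)
    where
    x+1 : ∀ x → x - -1ℤ ≡ 1ℤ + x
    x+1 = solve-∀

  1≉-1 : ¬ 1ℤ ≈ -1ℤ
  1≉-1 1≈-1 = ℕ.<⇒≱ 2<p (≈0-≤ _ (≈⇒-≈0 1≈-1))
    where
    2<p : 2 < p
    2<p = s≤s (ℕ.+-mono-≤ 1≤h (ℕ.≤-trans 1≤h (ℕ.m≤m+n h 0)))

  IsSign-≈⇒≡ : ∀ {a b} → IsSign a → IsSign b → a ≈ b → a ≡ b
  IsSign-≈⇒≡ (inj₁ refl) (inj₁ refl) _    = refl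
  IsSign-≈⇒≡ (inj₂ refl) (inj₂ refl) _    = refl
  IsSign-≈⇒≡ (inj₁ refl) (inj₂ refl) 1≈-1 = ⊥-elim (1≉-1 1≈-1)
  IsSign-≈⇒≡ (inj₂ refl) (inj₁ refl) -1≈1 = ⊥-elim (1≉-1 (≈-sym -1≈1))

  %≢0⇒≉0 : ∀ {m} → m % p ≢ 0 → ¬ + m ≈ 0ℤ
  %≢0⇒≉0 {m} m%p≢0 m≈0 = m%p≢0 (≈⇒%≡ {m} {0} m≈0)

  ≉0⇒%≢0 : ∀ {m} → ¬ + m ≈ 0ℤ → m % p ≢ 0
  ≉0⇒%≢0 {m} m≉0 m%p≡0 = m≉0 (%≡⇒≈ {m} {0} m%p≡0)

  pos-^ : ∀ x n → + (x ℕ.^ n) ≡ (+ x) ^ n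
  pos-^ x zero    = refl
  pos-^ x (suc n) = trans (ℤ.pos-* x (x ℕ.^ n)) (cong (+ x ℤ.*_) (pos-^ x n))

  units : List ℕ
  units = range (2 * h)

  ∈units-≉0 : ∀ {x} → x ∈ units → ¬ + x ≈ 0ℤ
  ∈units-≉0 = ∈-range-≉0 (ℕ.n<1+n (2 * h))

  ∈units-<p : ∀ {x} → x ∈ units → x < p
  ∈units-<p x∈ = s≤s (proj₂ (∈-range⁻ x∈))

  module Quotient (c : ℕ) (c≉0 : ¬ + c ≈ 0ℤ) where

    -- c / x, computed as c x^(p-2) by Fermat's little theorem
    quotient : ℕ → ℕ
    quotient x = (c * x ℕ.^ (2 * h ∸ 1)) % p

    x*quotient≈c : ∀ x → ¬ + x ≈ 0ℤ → + x ℤ.* + quotient x ≈ + c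
    x*quotient≈c x x≉0 = begin
      + x ℤ.* + quotient x                  ≈⟨ *-congˡ (+ x) (%-≈ (c * x ℕ.^ (2 * h ∸ 1))) ⟩
      + x ℤ.* + (c * x ℕ.^ (2 * h ∸ 1))     ≡⟨ cong (+ x ℤ.*_) (trans (ℤ.pos-* c (x ℕ.^ (2 * h ∸ 1))) (cong (+ c ℤ.*_) (pos-^ x (2 * h ∸ 1)))) ⟩
      + x ℤ.* (+ c ℤ.* (+ x) ^ (2 * h ∸ 1)) ≡⟨ swap (+ x) (+ c) ((+ x) ^ (2 * h ∸ 1)) ⟩
      + c ℤ.* (+ x) ^ suc (2 * h ∸ 1)       ≡⟨ cong (λ n → + c ℤ.* (+ x) ^ n) (ℕ.m+[n∸m]≡n (ℕ.≤-trans 1≤h (ℕ.m≤m+n h _))) ⟩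
      + c ℤ.* (+ x) ^ (2 * h)               ≈⟨ *-congˡ (+ c) (fermat x x≉0) ⟩
      + c ℤ.* 1ℤ                            ≡⟨ ℤ.*-identityʳ (+ c) ⟩
      + c                                   ∎
      where
      swap : ∀ a b d → a ℤ.* (b ℤ.* d) ≡ b ℤ.* (a ℤ.* d)
      swap = solve-∀

    quotient-≉0 : ∀ x → ¬ + x ≈ 0ℤ → ¬ + quotient x ≈ 0ℤ
    quotient-≉0 x x≉0 q≈0 = c≉0 (≈-trans (≈-sym (x*quotient≈c x x≉0))
      (≈-trans (*-congˡ (+ x) q≈0) (≈-reflexive (ℤ.*-zeroʳ (+ x)))))

    quotient∈units : ∀ {x} → x ∈ units → quotient x ∈ units
    quotient∈units {x} x∈ = ∈-range⁺
      (ℕ.n≢0⇒n>0 (λ q≡0 → quotient-≉0 x (∈units-≉0 x∈) (≈-reflexive (cong +_ q≡0))))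
      (ℕ.≤-pred (ℕ.m%n<n (c * x ℕ.^ (2 * h ∸ 1)) p))

    quotient-involutive : ∀ {x} → x ∈ units → quotient (quotient x) ≡ x
    quotient-involutive {x} x∈ = <-≈⇒≡ (ℕ.m%n<n (c * quotient x ℕ.^ (2 * h ∸ 1)) p) (∈units-<p x∈)
      (*-cancelˡ prime (quotient-≉0 x (∈units-≉0 x∈)) (begin
        + quotient x ℤ.* + quotient (quotient x) ≈⟨ x*quotient≈c (quotient x) (∈units-≉0 (quotient∈units x∈)) ⟩
        + c                                      ≈⟨ x*quotient≈c x (∈units-≉0 x∈) ⟨
        + x ℤ.* + quotient x                     ≡⟨ ℤ.*-comm (+ x) (+ quotient x) ⟩
        + quotient x ℤ.* + x                     ∎))

    pairing : ∀ xs → Unique xs → (∀ {x} → x ∈ xs → x ∈ units) →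
              (∀ {x} → x ∈ xs → quotient x ∈ xs) → (∀ {x} → x ∈ xs → quotient x ≢ x) →
              ∃[ e ] length xs ≡ e ℕ.+ e × ∏ +_ xs ≈ (+ c) ^ e
    pairing xs xs! xs⊆units closed no-fixpoint = involution-pairing xs xs!
      (record { closed = closed ; no-fixpoint = no-fixpoint ; involutive = λ x∈ → quotient-involutive (xs⊆units x∈) })
      (λ x∈ → x*quotient≈c _ (∈units-≉0 (xs⊆units x∈)))

  nonsquare⇒∏units≈c^h : ∀ c → c % p ≢ 0 → ¬ IsSquareMod p c → ∏ +_ units ≈ (+ c) ^ h
  nonsquare⇒∏units≈c^h c c%p≢0 ¬square = subst (λ n → ∏ +_ units ≈ (+ c) ^ n) e≡h (proj₂ (proj₂ paired))
    where
    open Quotient c (%≢0⇒≉0 c%p≢0)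
    no-fixpoint : ∀ {x} → x ∈ units → quotient x ≢ x
    no-fixpoint {x} x∈ q≡x = ¬square (x , ∈units-<p x∈ , ≈⇒%≡ (begin
      + (x * x)            ≡⟨ ℤ.pos-* x x ⟩
      + x ℤ.* + x          ≡⟨ cong (λ y → + x ℤ.* + y) q≡x ⟨
      + x ℤ.* + quotient x ≈⟨ x*quotient≈c x (∈units-≉0 x∈) ⟩
      + c                  ∎))
    paired : ∃[ e ] length units ≡ e ℕ.+ e × ∏ +_ units ≈ (+ c) ^ e
    paired = pairing units (range-unique (2 * h)) (λ x∈ → x∈) quotient∈units no-fixpoint
    e : ℕ
    e = proj₁ paired
    e+e≡h+h : e ℕ.+ e ≡ h ℕ.+ h
    e+e≡h+h = trans (sym (proj₁ (proj₂ paired))) (trans (length-range (2 * h)) (cong (h ℕ.+_) (ℕ.+-identityʳ h)))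
    e≡h : e ≡ h
    e≡h = trans (ℕ.n≡⌊n+n/2⌋ e) (trans (cong ⌊_/2⌋ e+e≡h+h) (sym (ℕ.n≡⌊n+n/2⌋ h)))

  *-self≈1⇒≈±1 : ∀ {a} → a ℤ.* a ≈ 1ℤ → a ≈ 1ℤ ⊎ a ≈ -1ℤ
  *-self≈1⇒≈±1 {a} a²≈1 with ≈0-*⁻ prime (≈-trans (≈-reflexive (factor a)) (≈⇒-≈0 a²≈1))
    where
    factor : ∀ a → (a - 1ℤ) ℤ.* (a - -1ℤ) ≡ a ℤ.* a - 1ℤ
    factor = solve-∀
  ... | inj₁ a-1≈0  = inj₁ (-≈0⇒≈ a-1≈0)
  ... | inj₂ a+1≈0  = inj₂ (-≈0⇒≈ a+1≈0)

  module Wilson where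

    m : ℕ
    m = 2 * h ∸ 2

    2+m≡2h : suc (suc m) ≡ 2 * h
    2+m≡2h = ℕ.m+[n∸m]≡n {2} (ℕ.+-mono-≤ 1≤h (ℕ.≤-trans 1≤h (ℕ.m≤m+n h 0)))

    middle : List ℕ
    middle = map suc (range m)

    ∈middle⁻ : ∀ {y} → y ∈ middle → 2 ≤ y × y ≤ suc m
    ∈middle⁻ y∈ with ∈-map⁻ suc y∈
    ... | z , z∈ , refl = s≤s (proj₁ (∈-range⁻ z∈)) , s≤s (proj₂ (∈-range⁻ z∈))

    ∈middle⁺ : ∀ {y} → 2 ≤ y → y ≤ suc m → y ∈ middle
    ∈middle⁺ {suc y} (s≤s 1≤y) (s≤s y≤m) = ∈-map⁺ suc (∈-range⁺ 1≤y y≤m)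

    middle⊆units : ∀ {y} → y ∈ middle → y ∈ units
    middle⊆units {y} y∈ = ∈-range⁺ (ℕ.≤-trans (s≤s z≤n) (proj₁ (∈middle⁻ y∈)))
      (subst (y ≤_) 2+m≡2h (ℕ.m≤n⇒m≤1+n (proj₂ (∈middle⁻ y∈))))

    ∈middle-≉1 : ∀ {y} → y ∈ middle → ¬ + y ≈ 1ℤ
    ∈middle-≉1 y∈ y≈1 with <-≈⇒≡ (∈units-<p (middle⊆units y∈)) 1<p y≈1
    ... | refl with ∈middle⁻ y∈
    ... | s≤s () , _

    ∈middle-≉-1 : ∀ {y} → y ∈ middle → ¬ + y ≈ -1ℤ
    ∈middle-≉-1 {y} y∈ y≈-1 = ℕ.<-irrefl y≡2h (ℕ.<-≤-trans (s≤s (proj₂ (∈middle⁻ y∈))) (ℕ.≤-reflexive 2+m≡2h))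
      where
      y≡2h : y ≡ 2 * h
      y≡2h = <-≈⇒≡ (∈units-<p (middle⊆units y∈)) (ℕ.n<1+n _) (≈-trans y≈-1 (≈-sym 2h≈-1))

    open Quotient 1 (0<j<p⇒≉0 (s≤s z≤n) 1<p)

    inverse-closed : ∀ {y} → y ∈ middle → quotient y ∈ middle
    inverse-closed {y} y∈ = ∈middle⁺ (≥2 (proj₁ bounds)) (≤1+m (proj₂ bounds))
      where
      bounds = ∈-range⁻ (quotient∈units (middle⊆units y∈))
      y*y⁻¹≈1 : + y ℤ.* + quotient y ≈ 1ℤ
      y*y⁻¹≈1 = x*quotient≈c y (∈units-≉0 (middle⊆units y∈))
      ≥2 : 1 ≤ quotient y → 2 ≤ quotient y
      ≥2 _ with quotient y in eq
      ... | suc (suc _) = s≤s (s≤s z≤n)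
      ... | suc zero    = ⊥-elim (∈middle-≉1 y∈
        (≈-trans (≈-reflexive (sym (ℤ.*-identityʳ (+ y)))) (subst (λ z → + y ℤ.* + z ≈ 1ℤ) eq y*y⁻¹≈1)))
      ≤1+m : quotient y ≤ 2 * h → quotient y ≤ suc m
      ≤1+m q≤2h with ℕ.m≤n⇒m<n∨m≡n (subst (quotient y ≤_) (sym 2+m≡2h) q≤2h)
      ... | inj₁ q<2+m = ℕ.≤-pred q<2+m
      ... | inj₂ q≡2+m = ⊥-elim (∈middle-≉-1 y∈ (begin
        + y                              ≡⟨ negate-twice (+ y) ⟩
        - (+ y ℤ.* -1ℤ)                  ≈⟨ -‿cong (*-congˡ (+ y) 2h≈-1) ⟨
        - (+ y ℤ.* + (2 * h))            ≡⟨ cong (λ z → - (+ y ℤ.* + z)) (trans q≡2+m 2+m≡2h) ⟨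
        - (+ y ℤ.* + quotient y)         ≈⟨ -‿cong y*y⁻¹≈1 ⟩
        -1ℤ                              ∎))
        where
        negate-twice : ∀ x → x ≡ - (x ℤ.* -1ℤ)
        negate-twice = solve-∀

    no-fixpoint : ∀ {y} → y ∈ middle → quotient y ≢ y
    no-fixpoint {y} y∈ q≡y with *-self≈1⇒≈±1 (subst (λ z → + y ℤ.* + z ≈ 1ℤ) q≡y (x*quotient≈c y (∈units-≉0 (middle⊆units y∈))))
    ... | inj₁ y≈1  = ∈middle-≉1 y∈ y≈1
    ... | inj₂ y≈-1 = ∈middle-≉-1 y∈ y≈-1

    ∏units≡2h*∏middle : ∏ +_ units ≡ + (2 * h) ℤ.* ∏ +_ middle
    ∏units≡2h*∏middle = trans (cong (λ n → ∏ +_ (range n)) (sym 2+m≡2h))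
      (cong₂ (λ n x → + n ℤ.* x) 2+m≡2h (trans (∏-range-suc m) (sym (∏-map +_ suc (range m)))))
      where
      ∏-range-suc : ∀ n → ∏ +_ (range (suc n)) ≡ ∏ (λ j → + suc j) (range n)
      ∏-range-suc zero    = refl
      ∏-range-suc (suc n) = cong (+ suc (suc n) ℤ.*_) (∏-range-suc n)

    wilson : ∏ +_ units ≈ -1ℤ
    wilson = begin
      ∏ +_ units                 ≡⟨ ∏units≡2h*∏middle ⟩
      + (2 * h) ℤ.* ∏ +_ middle  ≈⟨ *-cong 2h≈-1 (proj₂ (proj₂ paired)) ⟩
      -1ℤ ℤ.* 1ℤ ^ proj₁ paired  ≡⟨ cong (-1ℤ ℤ.*_) (ℤ.^-zeroˡ (proj₁ paired)) ⟩
      -1ℤ                        ∎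
      where
      paired : ∃[ e ] length middle ≡ e ℕ.+ e × ∏ +_ middle ≈ 1ℤ ^ e
      paired = pairing middle (unique-map suc (range m) (range-unique m) (λ _ _ → ℕ.suc-injective))
                 middle⊆units inverse-closed no-fixpoint

  euler-square : ∀ c → c % p ≢ 0 → IsSquareMod p c → (+ c) ^ h ≈ 1ℤ
  euler-square c c%p≢0 (x , _ , x²%p≡c%p) = begin
    (+ c) ^ h          ≈⟨ ^-cong h c≈x² ⟨
    ((+ x) ^ 2) ^ h    ≡⟨ ℤ.^-*-assoc (+ x) 2 h ⟩
    (+ x) ^ (2 * h)    ≈⟨ fermat x x≉0 ⟩
    1ℤ                 ∎
    where
    c≈x² : (+ x) ^ 2 ≈ + c
    c≈x² = ≈-trans (≈-reflexive (trans (cong (+ x ℤ.*_) (ℤ.*-identityʳ (+ x))) (sym (ℤ.pos-* x x))))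
                   (%≡⇒≈ x²%p≡c%p)
    x≉0 : ¬ + x ≈ 0ℤ
    x≉0 x≈0 = %≢0⇒≉0 c%p≢0 (≈-trans (≈-sym c≈x²) (*-congʳ ((+ x) ^ 1) x≈0))

  euler-nonsquare : ∀ c → c % p ≢ 0 → ¬ IsSquareMod p c → (+ c) ^ h ≈ -1ℤ
  euler-nonsquare c c%p≢0 ¬square = ≈-trans (≈-sym (nonsquare⇒∏units≈c^h c c%p≢0 ¬square)) Wilson.wilson

  euler-criterion : ∀ m → m % p ≢ 0 → legendre m p ≈ (+ m) ^ h
  euler-criterion m m%p≢0 with isSquareMod? m (2 * h)
  ... | yes square = ≈-trans (≈-reflexive (legendre-square m (2 * h) m%p≢0 square))
                             (≈-sym (euler-square m m%p≢0 square))
  ... | no ¬square = ≈-trans (≈-reflexive (legendre-nonsquare m (2 * h) m%p≢0 ¬square))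
                             (≈-sym (euler-nonsquare m m%p≢0 ¬square))

  legendre-isSign : ∀ m → m % p ≢ 0 → IsSign (legendre m p)
  legendre-isSign m m%p≢0 with isSquareMod? m (2 * h)
  ... | yes square = inj₁ (legendre-square m (2 * h) m%p≢0 square)
  ... | no ¬square = inj₂ (legendre-nonsquare m (2 * h) m%p≢0 ¬square)

  legendre-* : ∀ a b → legendre (a * b) p ≡ legendre a p ℤ.* legendre b p
  legendre-* a b with a % p ℕ.≟ 0 | b % p ℕ.≟ 0
  ... | yes a%p≡0 | _ = trans (legendre-≡0 (a * b) (2 * h) (≈⇒%≡ {a * b} {0} ab≈0))
                              (sym (cong (ℤ._* legendre b p) (legendre-≡0 a (2 * h) a%p≡0)))
    where
    ab≈0 : + (a * b) ≈ 0ℤ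
    ab≈0 = ≈-trans (≈-reflexive (ℤ.pos-* a b)) (*-congʳ (+ b) (%≡⇒≈ {a} {0} a%p≡0))
  ... | no _ | yes b%p≡0 = trans (legendre-≡0 (a * b) (2 * h) (≈⇒%≡ {a * b} {0} ab≈0))
                                 (sym (trans (cong (legendre a p ℤ.*_) (legendre-≡0 b (2 * h) b%p≡0)) (ℤ.*-zeroʳ (legendre a p))))
    where
    ab≈0 : + (a * b) ≈ 0ℤ
    ab≈0 = ≈-trans (≈-reflexive (ℤ.pos-* a b)) (≈-trans (*-congˡ (+ a) (%≡⇒≈ {b} {0} b%p≡0)) (≈-reflexive (ℤ.*-zeroʳ (+ a))))
  ... | no a%p≢0 | no b%p≢0 = IsSign-≈⇒≡ (legendre-isSign (a * b) ab%p≢0)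
        (IsSign-* (legendre-isSign a a%p≢0) (legendre-isSign b b%p≢0)) (begin
    legendre (a * b) p                  ≈⟨ euler-criterion (a * b) ab%p≢0 ⟩
    (+ (a * b)) ^ h                     ≡⟨ cong (_^ h) (ℤ.pos-* a b) ⟩
    (+ a ℤ.* + b) ^ h                   ≡⟨ ^-distribʳ-* (+ a) (+ b) h ⟩
    (+ a) ^ h ℤ.* (+ b) ^ h             ≈⟨ *-cong (euler-criterion a a%p≢0) (euler-criterion b b%p≢0) ⟨
    legendre a p ℤ.* legendre b p       ∎)
    where
    ab%p≢0 : (a * b) % p ≢ 0
    ab%p≢0 = ≉0⇒%≢0 (λ ab≈0 → ≉0-* prime (%≢0⇒≉0 {a} a%p≢0) (%≢0⇒≉0 {b} b%p≢0)
                                 (≈-trans (≈-reflexive (sym (ℤ.pos-* a b))) ab≈0))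
    ^-distribʳ-* : ∀ x y n → (x ℤ.* y) ^ n ≡ x ^ n ℤ.* y ^ n
    ^-distribʳ-* x y zero    = refl
    ^-distribʳ-* x y (suc n) = trans (cong (x ℤ.* y ℤ.*_) (^-distribʳ-* x y n)) (interchange x y (x ^ n) (y ^ n))
      where
      interchange : ∀ a b c d → a ℤ.* b ℤ.* (c ℤ.* d) ≡ a ℤ.* c ℤ.* (b ℤ.* d)
      interchange = solve-∀

  legendre≡-1^μ : ∀ q (q≉0 : ¬ + q ≈ 0ℤ) → legendre q p ≡ -1ℤ ^ GaussLemma.μ q q≉0
  legendre≡-1^μ q q≉0 = IsSign-≈⇒≡ (legendre-isSign q (≉0⇒%≢0 q≉0)) (-1^-isSign (GaussLemma.μ q q≉0))
    (≈-trans (euler-criterion q (≉0⇒%≢0 q≉0)) (GaussLemma.gauss q q≉0))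

  legendre-[p-1] : legendre (p ∸ 1) p ≡ χ p
  legendre-[p-1] = IsSign-≈⇒≡ (legendre-isSign (2 * h) 2h%p≢0) (-1^-isSign ⌊ p /2⌋) (begin
    legendre (2 * h) p   ≈⟨ euler-criterion (2 * h) 2h%p≢0 ⟩
    (+ (2 * h)) ^ h      ≈⟨ ^-cong h 2h≈-1 ⟩
    -1ℤ ^ h              ≡⟨ cong (-1ℤ ^_) (⌊odd/2⌋ h) ⟨
    χ p                  ∎)
    where
    2h%p≢0 : (2 * h) % p ≢ 0
    2h%p≢0 = ≉0⇒%≢0 (λ 2h≈0 → 0<j<p⇒≉0 (s≤s z≤n) 1<p (-‿cong (≈-trans (≈-sym 2h≈-1) 2h≈0)))

  legendre-1 : legendre 1 p ≡ 1ℤ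
  legendre-1 = legendre-square 1 (2 * h) 1%p≢0 (1 , 1<p , refl)
    where
    1%p≢0 : 1 % p ≢ 0
    1%p≢0 1%p≡0 = ℕ.1+n≢0 (trans (sym (ℕ.m<n⇒m%n≡m 1<p)) 1%p≡0)

module Reciprocity where

  open import Data.Nat as ℕ using (ℕ; zero; suc; _+_; _*_; _≤_; _<_; s≤s; z≤n; _%_; _/_; _≤?_; NonZero)
  import Data.Nat.Properties as ℕ
  import Data.Nat.DivMod as ℕ
  open import Data.Nat.Divisibility using (_∣_; divides; ∣⇒≤)
  open import Data.Nat.Primality using (Prime; euclidsLemma; prime[2]; prime⇒irreducible; prime⇒nonTrivial)
  open import Data.Nat.Tactic.RingSolver using (solve-∀)
  open import Data.Integer as ℤ using (ℤ; +_; 0ℤ; -1ℤ; _^_)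
  import Data.Integer.Properties as ℤ
  open import Data.List.Membership.Propositional using (_∈_)
  open import Data.Product using (_,_; proj₁; proj₂)
  open import Data.Sum using (inj₁; inj₂)
  open import Data.Empty using (⊥-elim)
  open import Relation.Binary.Definitions using (tri<; tri≈; tri>)
  open import Relation.Binary.PropositionalEquality
  open import Relation.Nullary using (¬_; yes; no)
  open import Function using (_∘_)
  open import Defs using (legendre)
  open BigOperators
  open Signs

  𝟙[_≤_] : ℕ → ℕ → ℕ
  𝟙[ a ≤ b ] with a ≤? b
  ... | yes _ = 1
  ... | no  _ = 0

  𝟙-yes : ∀ {a b} → a ≤ b → 𝟙[ a ≤ b ] ≡ 1
  𝟙-yes {a} {b} a≤b with a ≤? b
  ... | yes _   = refl
  ... | no  a≰b = ⊥-elim (a≰b a≤b)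

  𝟙-no : ∀ {a b} → ¬ a ≤ b → 𝟙[ a ≤ b ] ≡ 0
  𝟙-no {a} {b} a≰b with a ≤? b
  ... | yes a≤b = ⊥-elim (a≰b a≤b)
  ... | no  _   = refl

  𝟙[≤]+𝟙[≥] : ∀ {a b} → a ≢ b → 𝟙[ a ≤ b ] + 𝟙[ b ≤ a ] ≡ 1
  𝟙[≤]+𝟙[≥] {a} {b} a≢b with ℕ.<-cmp a b
  ... | tri< a<b _ b≮a = cong₂ _+_ (𝟙-yes (ℕ.<⇒≤ a<b)) (𝟙-no (ℕ.<⇒≱ a<b))
  ... | tri≈ _ a≡b _   = ⊥-elim (a≢b a≡b)
  ... | tri> _ _ b<a   = cong₂ _+_ (𝟙-no (ℕ.<⇒≱ b<a)) (𝟙-yes (ℕ.<⇒≤ b<a))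

  module _ (P : ℕ) .{{_ : NonZero P}} (m : ℕ) where

    #multiples-below : ∀ n → n ≤ m / P → ∑ (λ i → 𝟙[ P * i ≤ m ]) (range n) ≡ n
    #multiples-below zero    _     = refl
    #multiples-below (suc n) n<m/P = cong₂ _+_ (𝟙-yes P[1+n]≤m) (#multiples-below n (ℕ.<⇒≤ n<m/P))
      where
      P[1+n]≤m : P * suc n ≤ m
      P[1+n]≤m = ℕ.≤-trans (ℕ.*-monoʳ-≤ P n<m/P) (subst (_≤ m) (ℕ.*-comm (m / P) P) (ℕ.m/n*n≤m m P))

    #multiples : ∀ n → m / P ≤ n → ∑ (λ i → 𝟙[ P * i ≤ m ]) (range n) ≡ m / P
    #multiples zero    m/P≤0 = sym (ℕ.n≤0⇒n≡0 m/P≤0)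
    #multiples (suc n) m/P≤1+n with ℕ.m≤n⇒m<n∨m≡n m/P≤1+n
    ... | inj₂ m/P≡1+n = trans (#multiples-below (suc n) (ℕ.≤-reflexive (sym m/P≡1+n))) (sym m/P≡1+n)
    ... | inj₁ m/P<1+n = cong₂ _+_ (𝟙-no P[1+n]≰m) (#multiples n (ℕ.≤-pred m/P<1+n))
      where
      m<P[1+m/P] : m < P * suc (m / P)
      m<P[1+m/P] = subst (_< P * suc (m / P)) (sym (ℕ.m≡m%n+[m/n]*n m P))
        (subst (m % P + m / P * P <_) (regroup P (m / P)) (ℕ.+-monoˡ-< (m / P * P) (ℕ.m%n<n m P)))
        where
        regroup : ∀ P x → P + x * P ≡ P * suc x
        regroup = solve-∀
      P[1+n]≰m : ¬ P * suc n ≤ m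
      P[1+n]≰m P[1+n]≤m = ℕ.<-irrefl refl (ℕ.<-≤-trans (ℕ.≤-<-trans P[1+n]≤m m<P[1+m/P]) (ℕ.*-monoʳ-≤ P m/P<1+n))

  module Eisenstein (h : ℕ) (prime : Prime (suc (2 * h))) (k : ℕ)
                    (q≉0 : ¬ Congruence._≈_ (suc (2 * h)) (+ suc (2 * k)) 0ℤ) where

    open QuadraticResidues h prime using (p; module GaussLemma)
    open GaussLemma (suc (2 * k)) q≉0

    q : ℕ
    q = suc (2 * k)

    excess : ℕ → ℕ
    excess j with h ℕ.<? residue j
    ... | yes _ = p ℕ.∸ residue j
    ... | no  _ = 0

    q*j+2*excess : ∀ j → q * j + 2 * excess j ≡ p * (q * j / p) + folded j + p * overflow j
    q*j+2*excess j with h ℕ.<? residue j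
    ... | no  _ = trans (cong (λ z → z + 2 * 0) (ℕ.m≡m%n+[m/n]*n (q * j) p)) (regroup (residue j) (q * j / p) p)
      where
      regroup : ∀ r d p → r + d * p + 2 * 0 ≡ p * d + r + p * 0
      regroup = solve-∀
    ... | yes _ = begin
      q * j + 2 * (p ℕ.∸ residue j)
        ≡⟨ cong (λ z → z + 2 * (p ℕ.∸ residue j)) (ℕ.m≡m%n+[m/n]*n (q * j) p) ⟩
      residue j + q * j / p * p + 2 * (p ℕ.∸ residue j)
        ≡⟨ regroup (residue j) (q * j / p) (p ℕ.∸ residue j) ⟩
      p * (q * j / p) + (p ℕ.∸ residue j) + (residue j + (p ℕ.∸ residue j)) * 1
        ≡⟨ cong (λ z → p * (q * j / p) + (p ℕ.∸ residue j) + z * 1) (ℕ.m+[n∸m]≡n (ℕ.<⇒≤ (residue<p j))) ⟩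
      p * (q * j / p) + (p ℕ.∸ residue j) + p * 1 ∎
      where
      open ≡-Reasoning
      regroup : ∀ r d g → r + d * p + 2 * g ≡ p * d + g + (r + g) * 1
      regroup = solve-∀

    S F E : ℕ
    S = ∑ (λ j → j) (range h)
    F = ∑ (λ j → q * j / p) (range h)
    E = ∑ excess (range h)

    ∑folded≡S : ∑ folded (range h) ≡ S
    ∑folded≡S = trans (sym (∑-map (λ j → j) folded (range h))) (∑-↭ (λ j → j) folded-↭)

    q*S+2*E≡p*F+S+p*μ : q * S + 2 * E ≡ p * F + S + p * μ
    q*S+2*E≡p*F+S+p*μ = begin
      q * S + 2 * E
        ≡⟨ cong₂ _+_ (∑-*ˡ q (λ j → j) (range h)) (∑-*ˡ 2 excess (range h)) ⟨
      ∑ (λ j → q * j) (range h) + ∑ (λ j → 2 * excess j) (range h)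
        ≡⟨ ∑-+ (λ j → q * j) (λ j → 2 * excess j) (range h) ⟨
      ∑ (λ j → q * j + 2 * excess j) (range h)
        ≡⟨ ∑-cong (range h) (λ {j} _ → q*j+2*excess j) ⟩
      ∑ (λ j → p * (q * j / p) + folded j + p * overflow j) (range h)
        ≡⟨ ∑-+ (λ j → p * (q * j / p) + folded j) (λ j → p * overflow j) (range h) ⟩
      ∑ (λ j → p * (q * j / p) + folded j) (range h) + ∑ (λ j → p * overflow j) (range h)
        ≡⟨ cong₂ _+_ (∑-+ (λ j → p * (q * j / p)) folded (range h)) (∑-*ˡ p overflow (range h)) ⟩
      ∑ (λ j → p * (q * j / p)) (range h) + ∑ folded (range h) + p * μ
        ≡⟨ cong₂ (λ x y → x + y + p * μ) (∑-*ˡ p (λ j → q * j / p) (range h)) ∑folded≡S ⟩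
      p * F + S + p * μ ∎
      where open ≡-Reasoning

    2∣F+μ : 2 ∣ F + μ
    2∣F+μ with euclidsLemma p (F + μ) prime[2] (divides (k * S + E) 2[kS+E]≡p[F+μ])
      where
      2[kS+E]≡p[F+μ] : p * (F + μ) ≡ (k * S + E) * 2
      2[kS+E]≡p[F+μ] = sym (ℕ.+-cancelˡ-≡ S _ _ (trans (expand-q k S E) (trans q*S+2*E≡p*F+S+p*μ (collect p F S μ))))
        where
        expand-q : ∀ k S E → S + (k * S + E) * 2 ≡ suc (2 * k) * S + 2 * E
        expand-q = solve-∀
        collect : ∀ p F S μ → p * F + S + p * μ ≡ S + p * (F + μ)
        collect = solve-∀
    ... | inj₁ 2∣p   = ⊥-elim (Odd⇒¬2∣ (h , refl) 2∣p)
    ... | inj₂ 2∣F+μ = 2∣F+μ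

    eisenstein : -1ℤ ^ μ ≡ -1ℤ ^ F
    eisenstein = sym (-1^-cong-parity {F} {μ} 2∣F+μ)

  ¬prime∣prime : ∀ {a b} → Prime a → Prime b → a ≢ b → ¬ a ∣ b
  ¬prime∣prime prime-a prime-b a≢b a∣b with prime⇒irreducible prime-b a∣b
  ... | inj₁ refl = ℕ.<-irrefl refl (ℕ.nonTrivial⇒n>1 1 {{prime⇒nonTrivial prime-a}})
  ... | inj₂ a≡b  = a≢b a≡b

  module LatticePoints (h k : ℕ) (prime-p : Prime (suc (2 * h))) (prime-q : Prime (suc (2 * k))) (h≢k : h ≢ k) where

    p q : ℕ
    p = suc (2 * h)
    q = suc (2 * k)

    p≢q : p ≢ q
    p≢q p≡q = h≢k (ℕ.*-cancelˡ-≡ h k 2 (ℕ.suc-injective p≡q))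

    ¬p∣q*j : ∀ {a b j} → Prime a → Prime b → a ≢ b → 1 ≤ j → j < a → ¬ a ∣ b * j
    ¬p∣q*j {a} {b} {j} prime-a prime-b a≢b 1≤j j<a a∣bj with euclidsLemma b j prime-a a∣bj
    ... | inj₁ a∣b = ¬prime∣prime prime-a prime-b a≢b a∣b
    ... | inj₂ a∣j = ℕ.<⇒≱ j<a (∣⇒≤ {{ℕ.>-nonZero 1≤j}} a∣j)

    p*i≢q*j : ∀ {i j} → i ∈ range k → j ∈ range h → p * i ≢ q * j
    p*i≢q*j {i} {j} i∈ j∈ pi≡qj =
      ¬p∣q*j prime-p prime-q p≢q (proj₁ (∈-range⁻ j∈)) (s≤s (ℕ.≤-trans (proj₂ (∈-range⁻ j∈)) (ℕ.m≤m+n h _)))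
        (divides i (trans (sym pi≡qj) (ℕ.*-comm p i)))

    quotient≤ : ∀ {h k j} → j ≤ h → suc (2 * k) * j / suc (2 * h) ≤ k
    quotient≤ {h} {k} {j} j≤h = ℕ.≤-pred (ℕ.m<n*o⇒m/o<n (ℕ.≤-<-trans (ℕ.*-monoʳ-≤ (suc (2 * k)) j≤h)
      (subst (suc (2 * k) * h <_) (expand h k) (ℕ.m<m+n _ (s≤s z≤n)))))
      where
      expand : ∀ h k → suc (2 * k) * h + suc (h + k) ≡ suc k * suc (2 * h)
      expand = solve-∀

    F₁ F₂ : ℕ
    F₁ = ∑ (λ j → q * j / p) (range h)
    F₂ = ∑ (λ i → p * i / q) (range k)

    F₁≡ : F₁ ≡ ∑ (λ j → ∑ (λ i → 𝟙[ p * i ≤ q * j ]) (range k)) (range h)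
    F₁≡ = ∑-cong (range h) (λ {j} j∈ → sym (#multiples p (q * j) k (quotient≤ {h} {k} (proj₂ (∈-range⁻ j∈)))))

    F₂≡ : F₂ ≡ ∑ (λ j → ∑ (λ i → 𝟙[ q * j ≤ p * i ]) (range k)) (range h)
    F₂≡ = trans (∑-cong (range k) (λ {i} i∈ → sym (#multiples q (p * i) h (quotient≤ {k} {h} (proj₂ (∈-range⁻ i∈))))))
                (∑-swap (λ i j → 𝟙[ q * j ≤ p * i ]) (range k) (range h))

    -- each of the h k lattice points (i, j) lies strictly on one side of the line p i = q j
    F₁+F₂≡h*k : F₁ + F₂ ≡ h * k
    F₁+F₂≡h*k = begin
      F₁ + F₂
        ≡⟨ cong₂ _+_ F₁≡ F₂≡ ⟩
      ∑ (λ j → ∑ (λ i → 𝟙[ p * i ≤ q * j ]) (range k)) (range h) + ∑ (λ j → ∑ (λ i → 𝟙[ q * j ≤ p * i ]) (range k)) (range h)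
        ≡⟨ ∑-+ _ _ (range h) ⟨
      ∑ (λ j → ∑ (λ i → 𝟙[ p * i ≤ q * j ]) (range k) + ∑ (λ i → 𝟙[ q * j ≤ p * i ]) (range k)) (range h)
        ≡⟨ ∑-cong (range h) (λ j∈ → trans (sym (∑-+ _ _ (range k))) (∑-cong (range k) (λ i∈ → 𝟙[≤]+𝟙[≥] (p*i≢q*j i∈ j∈)))) ⟩
      ∑ (λ j → ∑ (λ i → 1) (range k)) (range h)
        ≡⟨ ∑-cong (range h) (λ _ → trans (∑-const 1 (range k)) (trans (cong (_* 1) (length-range k)) (ℕ.*-identityʳ k))) ⟩
      ∑ (λ j → k) (range h)
        ≡⟨ trans (∑-const k (range h)) (cong (_* k) (length-range h)) ⟩
      h * k ∎
      where open ≡-Reasoning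

    quadratic-reciprocity : legendre q p ℤ.* legendre p q ≡ -1ℤ ^ (h * k)
    quadratic-reciprocity = begin
      legendre q p ℤ.* legendre p q       ≡⟨ cong₂ ℤ._*_ (QuadraticResidues.legendre≡-1^μ h prime-p q q≉0)
                                                         (QuadraticResidues.legendre≡-1^μ k prime-q p p≉0) ⟩
      -1ℤ ^ μ₁ ℤ.* -1ℤ ^ μ₂               ≡⟨ cong₂ ℤ._*_ (Eisenstein.eisenstein h prime-p k q≉0) (Eisenstein.eisenstein k prime-q h p≉0) ⟩
      -1ℤ ^ F₁ ℤ.* -1ℤ ^ F₂               ≡⟨ ℤ.^-distribˡ-+-* -1ℤ F₁ F₂ ⟨
      -1ℤ ^ (F₁ + F₂)                     ≡⟨ cong (-1ℤ ^_) F₁+F₂≡h*k ⟩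
      -1ℤ ^ (h * k)                       ∎
      where
      open ≡-Reasoning
      q≉0 : ¬ Congruence._≈_ p (+ q) 0ℤ
      q≉0 q≈0 = ¬prime∣prime prime-p prime-q p≢q (Congruence.≈0⇒∣ p q≈0)
      p≉0 : ¬ Congruence._≈_ q (+ p) 0ℤ
      p≉0 p≈0 = ¬prime∣prime prime-q prime-p (p≢q ∘ sym) (Congruence.≈0⇒∣ q p≈0)
      μ₁ = QuadraticResidues.GaussLemma.μ h prime-p q q≉0
      μ₂ = QuadraticResidues.GaussLemma.μ k prime-q p p≉0

module Jacobi where

  open import Data.Nat as ℕ using (ℕ; zero; suc; _+_; _*_; _≤_; _<_; s≤s; z≤n; _%_; _/_; _∸_; _≡ᵇ_; NonZero)
  import Data.Nat.Properties as ℕ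
  import Data.Nat.DivMod as ℕ
  open import Data.Nat.Divisibility
    using (_∣_; divides; ∣-refl; ∣-trans; ∣⇒≤; m∣m*n; n∣m*n; m%n≡0⇒n∣m; n∣m⇒m%n≡0)
  open import Data.Nat.Divisibility.Core using (hasNonTrivialDivisor)
  open import Data.Nat.Coprimality using (Coprime)
  open import Data.Nat.ListAction using (product)
  open import Data.Nat.Primality
    using (Prime; _Rough_; rough∧∣⇒prime; prime⇒nonTrivial; productOfPrimes≥1)
  open import Data.Nat.Primality.Factorisation using (PrimeFactorisation; factors; factorise; factorisationUnique)
  open import Data.Bool using (T; true; false)
  open import Data.Integer as ℤ using (ℤ; 1ℤ; -1ℤ; _^_)
  import Data.Integer.Properties as ℤ
  open import Data.List using (List; []; _∷_)
  open import Data.List.Relation.Unary.All as All using (All; []; _∷_)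
  open import Data.Product using (_×_; _,_; proj₁; proj₂)
  open import Data.Sum using (inj₁; inj₂)
  open import Data.Empty using (⊥-elim)
  open import Function using (_∘_)
  open import Relation.Binary.PropositionalEquality
  open import Relation.Nullary using (¬_)
  open import Defs using (leastDivFrom; lpf; jacobiF; jacobi; legendre)
  open BigOperators
  open Signs
  open Legendre using (legendre-%)
  module QR = QuadraticResidues
  open Reciprocity using (module LatticePoints)

  NoDivisorBelow : ℕ → ℕ → Set
  NoDivisorBelow d n = ∀ {e} → 2 ≤ e → e < d → ¬ e ∣ n

  record IsLeastDivisor (r n : ℕ) : Set where
    field
      isDivisor  : r ∣ n
      nontrivial : 2 ≤ r
      least      : NoDivisorBelow r n

  leastDivFrom-isLeast : ∀ fuel d n → 2 ≤ d → 2 ≤ n → NoDivisorBelow d n → n < fuel + d →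
                         IsLeastDivisor (leastDivFrom fuel d n) n
  leastDivFrom-isLeast zero d n _ 2≤n none n<d =
    record { isDivisor = ∣-refl ; nontrivial = 2≤n ; least = λ 2≤e e<n → none 2≤e (ℕ.<-trans e<n n<d) }
  leastDivFrom-isLeast (suc fuel) (suc zero) n (s≤s ()) _ _ _
  leastDivFrom-isLeast (suc fuel) d@(suc (suc _)) n 2≤d 2≤n none n<1+fuel+d with n % d ≡ᵇ 0 in eq
  ... | true  = record { isDivisor = m%n≡0⇒n∣m n d (ℕ.≡ᵇ⇒≡ _ _ (subst T (sym eq) _)) ; nontrivial = 2≤d ; least = none }
  ... | false = leastDivFrom-isLeast fuel (suc d) n (ℕ.m≤n⇒m≤1+n 2≤d) 2≤n none′
                  (subst (n <_) (sym (ℕ.+-suc fuel d)) n<1+fuel+d)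
    where
    none′ : NoDivisorBelow (suc d) n
    none′ 2≤e e<1+d e∣n with ℕ.m≤n⇒m<n∨m≡n (ℕ.≤-pred e<1+d)
    ... | inj₁ e<d  = none 2≤e e<d e∣n
    ... | inj₂ refl = subst T eq (ℕ.≡⇒≡ᵇ _ _ (n∣m⇒m%n≡0 n d e∣n))

  lpf-isLeast : ∀ n → 2 ≤ n → IsLeastDivisor (lpf n) n
  lpf-isLeast n 2≤n = leastDivFrom-isLeast n 2 n ℕ.≤-refl 2≤n (λ 2≤e e<2 → ⊥-elim (ℕ.<⇒≱ e<2 2≤e)) (ℕ.m<m+n n (s≤s z≤n))

  isLeastDivisor⇒prime : ∀ {r n} → IsLeastDivisor r n → Prime r
  isLeastDivisor⇒prime {r} {n} least = rough∧∣⇒prime {{ℕ.n>1⇒nonTrivial (IsLeastDivisor.nontrivial least)}} rough (IsLeastDivisor.isDivisor least)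
    where
    rough : r Rough n
    rough (hasNonTrivialDivisor e<r e∣n) = IsLeastDivisor.least least (ℕ.nonTrivial⇒n>1 _) e<r e∣n

  -- the prime factors in the order in which jacobiF peels them off
  primeFactors : ℕ → ℕ → List ℕ
  primeFactors zero n = []
  primeFactors (suc fuel) zero = []
  primeFactors (suc fuel) (suc zero) = []
  primeFactors (suc fuel) n@(suc (suc _)) with lpf n
  ... | zero       = []
  ... | p@(suc _) = p ∷ primeFactors fuel (n / p)

  jacobiF≡∏ : ∀ fuel m n → jacobiF fuel m n ≡ ∏ (legendre m) (primeFactors fuel n)
  jacobiF≡∏ zero m n = refl
  jacobiF≡∏ (suc fuel) m zero = refl
  jacobiF≡∏ (suc fuel) m (suc zero) = refl
  jacobiF≡∏ (suc fuel) m n@(suc (suc _)) with lpf n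
  ... | zero      = refl
  ... | p@(suc _) = cong (legendre m p ℤ.*_) (jacobiF≡∏ fuel m (n / p))

  primeFactors-factorisation : ∀ fuel n → 1 ≤ n → n ≤ fuel → PrimeFactorisation n
  primeFactors-factorisation fuel n 1≤n n≤fuel = record
    { factors = primeFactors fuel n ; isFactorisation = proj₂ (spec fuel n 1≤n n≤fuel) ; factorsPrime = proj₁ (spec fuel n 1≤n n≤fuel) }
    where
    spec : ∀ fuel n → 1 ≤ n → n ≤ fuel → All Prime (primeFactors fuel n) × n ≡ product (primeFactors fuel n)
    spec (suc fuel) (suc zero) _ _ = [] , refl
    spec (suc fuel) n@(suc (suc _)) _ n≤1+fuel with lpf n | lpf-isLeast n (s≤s (s≤s z≤n))
    ... | zero      | least = ⊥-elim (ℕ.<⇒≱ (IsLeastDivisor.nontrivial least) z≤n)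
    ... | p@(suc _) | least with spec fuel (n / p) (ℕ.n≢0⇒n>0 n/p≢0) (ℕ.≤-pred (ℕ.<-≤-trans (ℕ.m/n<m n p (IsLeastDivisor.nontrivial least)) n≤1+fuel))
      where
      n/p≢0 : n / p ≢ 0
      n/p≢0 n/p≡0 = ℕ.<⇒≱ (ℕ.m/n≡0⇒m<n n/p≡0) (∣⇒≤ (IsLeastDivisor.isDivisor least))
    ... | primes , n/p≡∏ = isLeastDivisor⇒prime least ∷ primes
                         , trans (sym (ℕ.m*[n/m]≡n (IsLeastDivisor.isDivisor least))) (cong (p *_) n/p≡∏)

  jacobi≡∏legendre : ∀ m {n} (f : PrimeFactorisation n) → jacobi m n ≡ ∏ (legendre m) (factors f)
  jacobi≡∏legendre m {n} f = trans (jacobiF≡∏ n m n)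
    (∏-↭ (legendre m) (factorisationUnique (primeFactors-factorisation n n 1≤n ℕ.≤-refl) f))
    where
    1≤n : 1 ≤ n
    1≤n = subst (1 ≤_) (sym (PrimeFactorisation.isFactorisation f)) (productOfPrimes≥1 (PrimeFactorisation.factorsPrime f))

  OddPrime : ℕ → Set
  OddPrime p = Prime p × Odd p

  module _ {p : ℕ} where

    legendre-*′ : OddPrime p → ∀ a b → legendre (a * b) p ≡ legendre a p ℤ.* legendre b p
    legendre-*′ (prime-p , h , refl) = QR.legendre-* h prime-p

    legendre-isSign′ : OddPrime p → ∀ a → ¬ p ∣ a → IsSign (legendre a p)
    legendre-isSign′ (prime-p , h , refl) a p∤a = QR.legendre-isSign h prime-p a (p∤a ∘ m%n≡0⇒n∣m a p)

    legendre-1′ : OddPrime p → legendre 1 p ≡ 1ℤ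
    legendre-1′ (prime-p , h , refl) = QR.legendre-1 h prime-p

    legendre-[p-1]′ : OddPrime p → legendre (p ∸ 1) p ≡ χ p
    legendre-[p-1]′ (prime-p , h , refl) = QR.legendre-[p-1] h prime-p

    legendre-product : OddPrime p → ∀ qs → legendre (product qs) p ≡ ∏ (λ q → legendre q p) qs
    legendre-product op []       = legendre-1′ op
    legendre-product op (q ∷ qs) = trans (legendre-*′ op q (product qs)) (cong (legendre q p ℤ.*_) (legendre-product op qs))

  legendre-reciprocity : ∀ {p q} → OddPrime p → OddPrime q → p ≢ q → legendre q p ℤ.* legendre p q ≡ ε p q
  legendre-reciprocity (prime-p , h , refl) (prime-q , k , refl) p≢q =
    trans (LatticePoints.quadratic-reciprocity h k prime-p prime-q (p≢q ∘ cong (λ t → suc (2 * t))))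
          (cong₂ (λ x y → -1ℤ ^ (x * y)) (sym (⌊odd/2⌋ h)) (sym (⌊odd/2⌋ k)))

  ∣product : ∀ ps → All (_∣ product ps) ps
  ∣product []       = []
  ∣product (p ∷ ps) = m∣m*n (product ps) ∷ All.map (λ q∣ → ∣-trans q∣ (n∣m*n p)) (∣product ps)

  module OddFactorisation {n : ℕ} (odd : Odd n) where

    private
      instance
        n≢0 : NonZero n
        n≢0 = Odd⇒NonZero odd

    primes : List ℕ
    primes = factors (factorise n)

    n≡∏primes : n ≡ product primes
    n≡∏primes = PrimeFactorisation.isFactorisation (factorise n)

    primes-divide : All (_∣ n) primes
    primes-divide = subst (λ m → All (_∣ m) primes) (sym n≡∏primes) (∣product primes)

    primes-odd : All OddPrime primes
    primes-odd = All.zipWith (λ (prime-p , p∣n) → prime-p , ¬2∣⇒Odd (λ 2∣p → Odd⇒¬2∣ odd (∣-trans 2∣p p∣n)))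
                   (PrimeFactorisation.factorsPrime (factorise n) , primes-divide)

    primes-odd-divide : All (λ p → OddPrime p × p ∣ n) primes
    primes-odd-divide = All.zip (primes-odd , primes-divide)

    jacobi≡∏ : ∀ a → jacobi a n ≡ ∏ (legendre a) primes
    jacobi≡∏ a = jacobi≡∏legendre a (factorise n)

    ∏-cong-primes : ∀ {f g : ℕ → ℤ} → (∀ {p} → OddPrime p → p ∣ n → f p ≡ g p) → ∏ f primes ≡ ∏ g primes
    ∏-cong-primes f≡g = ∏-cong primes (λ p∈ → let (op , p∣n) = All.lookup primes-odd-divide p∈ in f≡g op p∣n)

  module _ {n : ℕ} (odd : Odd n) where

    open OddFactorisation odd

    jacobi-% : ∀ a b .{{_ : NonZero n}} → a % n ≡ b % n → jacobi a n ≡ jacobi b n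
    jacobi-% a b a≡b = trans (jacobi≡∏ a) (trans (∏-cong-primes same) (sym (jacobi≡∏ b)))
      where
      same : ∀ {p} → OddPrime p → p ∣ n → legendre a p ≡ legendre b p
      same (prime-p , h , refl) p∣n = legendre-% a b (2 * h)
        (trans (sym (ℕ.m∣n⇒o%n%m≡o%m _ n a p∣n)) (trans (cong (_% suc (2 * h)) a≡b) (ℕ.m∣n⇒o%n%m≡o%m _ n b p∣n)))

    jacobi-* : ∀ a b → jacobi (a * b) n ≡ jacobi a n ℤ.* jacobi b n
    jacobi-* a b = begin
      jacobi (a * b) n                                     ≡⟨ jacobi≡∏ (a * b) ⟩
      ∏ (legendre (a * b)) primes                          ≡⟨ ∏-cong-primes (λ op _ → legendre-*′ op a b) ⟩
      ∏ (λ p → legendre a p ℤ.* legendre b p) primes       ≡⟨ ∏-* (legendre a) (legendre b) primes ⟩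
      ∏ (legendre a) primes ℤ.* ∏ (legendre b) primes      ≡⟨ cong₂ ℤ._*_ (jacobi≡∏ a) (jacobi≡∏ b) ⟨
      jacobi a n ℤ.* jacobi b n                            ∎
      where open ≡-Reasoning

    jacobi-isSign : ∀ a → Coprime a n → IsSign (jacobi a n)
    jacobi-isSign a coprime = subst IsSign (sym (jacobi≡∏ a)) (IsSign-∏ (legendre a) primes primes-odd-divide
      (λ (op , p∣n) → legendre-isSign′ op a (λ p∣a → ℕ.<⇒≢ (ℕ.nonTrivial⇒n>1 _ {{prime⇒nonTrivial (proj₁ op)}}) (sym (coprime (p∣a , p∣n))))))

    jacobi-1 : jacobi 1 n ≡ 1ℤ
    jacobi-1 = trans (jacobi≡∏ 1) (trans (∏-cong-primes (λ op _ → legendre-1′ op)) (∏-1 primes))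

    jacobi-[n-1] : jacobi (n ∸ 1) n ≡ χ n
    jacobi-[n-1] = begin
      jacobi (n ∸ 1) n              ≡⟨ jacobi≡∏ (n ∸ 1) ⟩
      ∏ (legendre (n ∸ 1)) primes   ≡⟨ ∏-cong-primes [n-1]≡[p-1] ⟩
      ∏ χ primes                    ≡⟨ χ-product primes (All.map proj₂ primes-odd) ⟩
      χ (product primes)            ≡⟨ cong χ n≡∏primes ⟨
      χ n                           ∎
      where
      open ≡-Reasoning
      [n-1]≡[p-1] : ∀ {p} → OddPrime p → p ∣ n → legendre (n ∸ 1) p ≡ χ p
      [n-1]≡[p-1] op@(prime-p , h , refl) (divides (suc c) n≡) = trans
        (legendre-% (n ∸ 1) (2 * h) (2 * h) (trans (cong (λ m → (m ∸ 1) % suc (2 * h)) n≡) (ℕ.[m+kn]%n≡m%n (2 * h) c (suc (2 * h)))))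
        (legendre-[p-1]′ op)
      [n-1]≡[p-1] _ (divides zero n≡0) = ⊥-elim (ℕ.0≢1+n (trans (sym n≡0) (proj₂ odd)))

  jacobi-reciprocity : ∀ {m n} → Odd m → Odd n → Coprime m n → jacobi m n ℤ.* jacobi n m ≡ ε m n
  jacobi-reciprocity {m} {n} odd-m odd-n coprime = begin
    jacobi m n ℤ.* jacobi n m
      ≡⟨ cong₂ ℤ._*_ (trans (N.jacobi≡∏ m) (N.∏-cong-primes (λ {p} op _ → trans (cong (λ z → legendre z p) M.n≡∏primes) (legendre-product op qs))))
                     (trans (M.jacobi≡∏ n) (M.∏-cong-primes (λ {q} oq _ → trans (cong (λ z → legendre z q) N.n≡∏primes) (legendre-product oq ps)))) ⟩
    ∏ (λ p → ∏ (λ q → legendre q p) qs) ps ℤ.* ∏ (λ q → ∏ (λ p → legendre p q) ps) qs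
      ≡⟨ cong (∏ (λ p → ∏ (λ q → legendre q p) qs) ps ℤ.*_) (∏-swap (λ q p → legendre p q) qs ps) ⟩
    ∏ (λ p → ∏ (λ q → legendre q p) qs) ps ℤ.* ∏ (λ p → ∏ (λ q → legendre p q) qs) ps
      ≡⟨ ∏-* _ _ ps ⟨
    ∏ (λ p → ∏ (λ q → legendre q p) qs ℤ.* ∏ (λ q → legendre p q) qs) ps
      ≡⟨ N.∏-cong-primes (λ op p∣n → trans (sym (∏-* _ _ qs)) (M.∏-cong-primes (λ oq q∣m →
           legendre-reciprocity op oq (λ p≡q → distinct op p∣n (subst (_∣ m) (sym p≡q) q∣m))))) ⟩
    ∏ (λ p → ∏ (ε p) qs) ps
      ≡⟨ N.∏-cong-primes (λ {p} _ _ → ε-productʳ p qs (All.map proj₂ M.primes-odd)) ⟩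
    ∏ (λ p → ε p (product qs)) ps
      ≡⟨ ε-productˡ ps (product qs) (All.map proj₂ N.primes-odd) ⟩
    ε (product ps) (product qs)
      ≡⟨ cong₂ ε N.n≡∏primes M.n≡∏primes ⟨
    ε n m
      ≡⟨ ε-comm n m ⟩
    ε m n ∎
    where
    open ≡-Reasoning
    module M = OddFactorisation odd-m
    module N = OddFactorisation odd-n
    ps = N.primes
    qs = M.primes
    distinct : ∀ {p} → OddPrime p → p ∣ n → ¬ p ∣ m
    distinct (prime-p , _) p∣n p∣m = ℕ.<⇒≢ (ℕ.nonTrivial⇒n>1 _ {{prime⇒nonTrivial prime-p}}) (sym (coprime (p∣m , p∣n)))

module ContinuedFractionOfE where

  open import Data.Nat as ℕ using (ℕ; zero; suc; _+_; _*_; _≤_; _<_; s≤s; z≤n; _%_; _/_; _∸_; ⌊_/2⌋; _≡ᵇ_; NonZero)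
  import Data.Nat.Properties as ℕ
  import Data.Nat.DivMod as ℕ
  open import Data.Nat.Divisibility using (_∣_; divides; ∣1⇒≡1; ∣m+n∣m⇒∣n; ∣n⇒∣m*n; m%n≡0⇒n∣m)
  open import Data.Nat.Coprimality using (Coprime)
  open import Data.Nat.Tactic.RingSolver using (solve-∀)
  open import Data.Bool using (Bool; true; false; if_then_else_; not)
  open import Data.Integer as ℤ using (ℤ; 1ℤ)
  import Data.Integer.Properties as ℤ
  open import Data.Product using (_×_; _,_; proj₁; proj₂)
  open import Data.Empty using (⊥-elim)
  open import Data.List using (upTo)
  open import Data.List.Membership.Propositional using (find)
  open import Data.List.Membership.Propositional.Properties using (∈-upTo⁺)
  open import Data.List.Relation.Unary.All as All using (All; all?)
  open import Data.List.Relation.Unary.Any using (Any; any?)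
  open import Relation.Binary.Definitions using (DecidableEquality)
  open import Relation.Binary.PropositionalEquality
  open import Relation.Nullary using (yes; no; ¬?)
  import Relation.Nullary.Decidable as Dec
  open import Relation.Nullary.Decidable using (from-yes; _→-dec_)
  open import Defs using (eCF; S; T; jacobi; JVal; star; eJacobiSeq) renaming (sym to symbol)
  open BigOperators using (range; ∈-range⁺)
  open Signs
  open Jacobi

  -- a_m for m ≥ 1 in terms of m and m % 3; when m ≡ 2 (mod 3), a_m = 2(m+1)/3 = 2(⌊m/3⌋+1)
  partialQuotient : ℕ → ℕ → ℕ
  partialQuotient m 2 = 2 * (m / 3 + 1)
  partialQuotient m _ = 1

  2[m+1]/3 : ∀ m → m % 3 ≡ 2 → 2 * (m + 1) / 3 ≡ 2 * (m / 3 + 1)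
  2[m+1]/3 m m%3≡2 = begin
    2 * (m + 1) / 3                  ≡⟨ cong (λ z → 2 * (z + 1) / 3) (ℕ.m≡m%n+[m/n]*n m 3) ⟩
    2 * (m % 3 + m / 3 * 3 + 1) / 3  ≡⟨ cong (λ r → 2 * (r + m / 3 * 3 + 1) / 3) m%3≡2 ⟩
    2 * (2 + m / 3 * 3 + 1) / 3      ≡⟨ cong (_/ 3) (regroup (m / 3)) ⟩
    2 * (m / 3 + 1) * 3 / 3          ≡⟨ ℕ.m*n/n≡m (2 * (m / 3 + 1)) 3 ⟩
    2 * (m / 3 + 1)                  ∎
    where
    open ≡-Reasoning
    regroup : ∀ q → 2 * (2 + q * 3 + 1) ≡ 2 * (q + 1) * 3
    regroup = solve-∀

  eCF≡partialQuotient : ∀ k → eCF (suc k) ≡ partialQuotient (suc k) (suc k % 3)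
  eCF≡partialQuotient k with suc k % 3 in eq
  ... | 0                 = refl
  ... | 1                 = refl
  ... | 2                 = 2[m+1]/3 (suc k) eq
  ... | suc (suc (suc _)) = refl

  eCF≥1 : ∀ k → 1 ≤ eCF (suc k)
  eCF≥1 k = subst (1 ≤_) (sym (eCF≡partialQuotient k)) (partialQuotient≥1 (suc k) (suc k % 3))
    where
    partialQuotient≥1 : ∀ m r → 1 ≤ partialQuotient m r
    partialQuotient≥1 m 0                 = s≤s z≤n
    partialQuotient≥1 m 1                 = s≤s z≤n
    partialQuotient≥1 m 2                 = ℕ.≤-trans (subst (1 ≤_) (ℕ.+-comm 1 (m / 3)) (s≤s z≤n)) (ℕ.m≤m+n _ _)
    partialQuotient≥1 m (suc (suc (suc _))) = s≤s z≤n

  odd-eCF≡1 : ∀ k → eCF (suc k) % 2 ≡ 1 → eCF (suc k) ≡ 1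
  odd-eCF≡1 k odd = trans (eCF≡partialQuotient k)
    (odd-partialQuotient≡1 (suc k) (suc k % 3) (trans (cong (_% 2) (sym (eCF≡partialQuotient k))) odd))
    where
    odd-partialQuotient≡1 : ∀ m r → partialQuotient m r % 2 ≡ 1 → partialQuotient m r ≡ 1
    odd-partialQuotient≡1 m 0                 _   = refl
    odd-partialQuotient≡1 m 1                 _   = refl
    odd-partialQuotient≡1 m 2                 odd = ⊥-elim (ℕ.0≢1+n (trans (sym even) odd))
      where
      even : 2 * (m / 3 + 1) % 2 ≡ 0
      even = trans (cong (_% 2) (ℕ.*-comm 2 (m / 3 + 1))) (ℕ.m*n%n≡0 (m / 3 + 1) 2)
    odd-partialQuotient≡1 m (suc (suc (suc _))) _   = refl

  eCF-+24 : ∀ k → eCF (suc k + 24) % 4 ≡ eCF (suc k) % 4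
  eCF-+24 k = begin
    eCF (suc k + 24) % 4                                      ≡⟨ cong (_% 4) (eCF≡partialQuotient (k + 24)) ⟩
    partialQuotient (suc k + 24) ((suc k + 24) % 3) % 4       ≡⟨ cong (λ r → partialQuotient (suc k + 24) r % 4) (ℕ.[m+kn]%n≡m%n (suc k) 8 3) ⟩
    partialQuotient (suc k + 24) (suc k % 3) % 4              ≡⟨ partialQuotient-+24 (suc k) (suc k % 3) ⟩
    partialQuotient (suc k) (suc k % 3) % 4                   ≡⟨ cong (_% 4) (eCF≡partialQuotient k) ⟨
    eCF (suc k) % 4                                           ∎
    where
    open ≡-Reasoning
    partialQuotient-+24 : ∀ m r → partialQuotient (m + 24) r % 4 ≡ partialQuotient m r % 4
    partialQuotient-+24 m 0                 = refl
    partialQuotient-+24 m 1                 = refl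
    partialQuotient-+24 m 2                 = begin
      2 * ((m + 24) / 3 + 1) % 4        ≡⟨ cong (λ z → 2 * (z + 1) % 4) (ℕ.+-distrib-/-∣ʳ m (divides 8 refl)) ⟩
      2 * (m / 3 + 8 + 1) % 4           ≡⟨ cong (_% 4) (regroup (m / 3)) ⟩
      (2 * (m / 3 + 1) + 4 * 4) % 4     ≡⟨ ℕ.[m+kn]%n≡m%n (2 * (m / 3 + 1)) 4 4 ⟩
      2 * (m / 3 + 1) % 4               ∎
      where
      regroup : ∀ q → 2 * (q + 8 + 1) ≡ 2 * (q + 1) + 4 * 4
      regroup = solve-∀
    partialQuotient-+24 m (suc (suc (suc _))) = refl

  even? : ℕ → Bool
  even? zero    = true
  even? (suc n) = not (even? n)

  -- s_k t_{k-1} - s_{k-1} t_k = (-1)^(k+1), with the subtraction moved to the other side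
  Determinant : Bool → ℕ → Set
  Determinant true  n = S (suc n) * T n + 1 ≡ S n * T (suc n)
  Determinant false n = S (suc n) * T n ≡ S n * T (suc n) + 1

  determinant : ∀ n → Determinant (even? n) n
  determinant zero    = refl
  determinant (suc n) with even? n | determinant n
  ... | true  | det = begin
    (a * S (suc n) + S n) * T (suc n)            ≡⟨ ℕ.*-distribʳ-+ (T (suc n)) (a * S (suc n)) (S n) ⟩
    a * S (suc n) * T (suc n) + S n * T (suc n)  ≡⟨ cong (a * S (suc n) * T (suc n) +_) det ⟨
    a * S (suc n) * T (suc n) + (S (suc n) * T n + 1)
                                                 ≡⟨ regroup a (S (suc n)) (T n) (T (suc n)) ⟩
    S (suc n) * (a * T (suc n) + T n) + 1        ∎
    where
    open ≡-Reasoning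
    a = eCF (suc n)
    regroup : ∀ a s t₀ t₁ → a * s * t₁ + (s * t₀ + 1) ≡ s * (a * t₁ + t₀) + 1
    regroup = solve-∀
  ... | false | det = begin
    (a * S (suc n) + S n) * T (suc n) + 1          ≡⟨ regroup a (S n) (S (suc n)) (T (suc n)) ⟩
    a * S (suc n) * T (suc n) + (S n * T (suc n) + 1) ≡⟨ cong (a * S (suc n) * T (suc n) +_) det ⟨
    a * S (suc n) * T (suc n) + S (suc n) * T n    ≡⟨ factor a (S (suc n)) (T n) (T (suc n)) ⟩
    S (suc n) * (a * T (suc n) + T n)              ∎
    where
    open ≡-Reasoning
    a = eCF (suc n)
    regroup : ∀ a s₀ s t₁ → (a * s + s₀) * t₁ + 1 ≡ a * s * t₁ + (s₀ * t₁ + 1)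
    regroup = solve-∀
    factor : ∀ a s t₀ t₁ → a * s * t₁ + s * t₀ ≡ s * (a * t₁ + t₀)
    factor = solve-∀

  coprime-T-T : ∀ n → Coprime (T n) (T (suc n))
  coprime-T-T n {d} (d∣Tn , d∣Tn+1) with even? n | determinant n
  ... | true  | det = ∣1⇒≡1 (∣m+n∣m⇒∣n (subst (d ∣_) (sym det) (∣n⇒∣m*n (S n) d∣Tn+1)) (∣n⇒∣m*n (S (suc n)) d∣Tn))
  ... | false | det = ∣1⇒≡1 (∣m+n∣m⇒∣n (subst (d ∣_) det (∣n⇒∣m*n (S (suc n)) d∣Tn)) (∣n⇒∣m*n (S n) d∣Tn+1))

  T-step₁ : ∀ n → eCF (suc n) ≡ 1 → T (suc (suc n)) ≡ T (suc n) + T n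
  T-step₁ n a≡1 = trans (cong (λ a → a * T (suc n) + T n) a≡1) (cong (_+ T n) (ℕ.*-identityˡ (T (suc n))))

  coprime-T-T₂ : ∀ n → eCF (suc n) ≡ 1 → Coprime (T n) (T (suc (suc n)))
  coprime-T-T₂ n a≡1 {d} (d∣Tn , d∣Tn+2) =
    coprime-T-T n (d∣Tn , ∣m+n∣m⇒∣n (subst (d ∣_) (trans (T-step₁ n a≡1) (ℕ.+-comm (T (suc n)) (T n))) d∣Tn+2) d∣Tn)

  T-positive : ∀ n → 1 ≤ T (suc n)
  T-positive zero    = s≤s z≤n
  T-positive (suc n) = ℕ.≤-trans (T-positive n) (ℕ.≤-trans (ℕ.m≤n*m (T (suc n)) (eCF (suc n)) {{ℕ.>-nonZero (eCF≥1 n)}}) (ℕ.m≤m+n _ (T n)))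

  T-nonZero : ∀ n → NonZero (T (suc n))
  T-nonZero n = ℕ.>-nonZero (T-positive n)

  T-% : ∀ n .{{_ : NonZero (T (suc n))}} → T (suc (suc n)) % T (suc n) ≡ T n % T (suc n)
  T-% n = trans (cong (_% T (suc n)) (ℕ.+-comm (eCF (suc n) * T (suc n)) (T n))) (ℕ.[m+kn]%n≡m%n (T n) (eCF (suc n)) (T (suc n)))

  V : ℕ → ℤ
  V k = jacobi (T k) (T (suc k))

  V-isSign : ∀ k → Odd (T (suc k)) → IsSign (V k)
  V-isSign k odd = jacobi-isSign odd (T k) (coprime-T-T k)

  private
    *-sign⁻¹ : ∀ {x v e : ℤ} → x ℤ.* v ≡ e → v ℤ.* v ≡ 1ℤ → x ≡ e ℤ.* v
    *-sign⁻¹ {x} {v} {e} xv≡e v²≡1 = begin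
      x                 ≡⟨ ℤ.*-identityʳ x ⟨
      x ℤ.* 1ℤ          ≡⟨ cong (x ℤ.*_) v²≡1 ⟨
      x ℤ.* (v ℤ.* v)   ≡⟨ ℤ.*-assoc x v v ⟨
      x ℤ.* v ℤ.* v     ≡⟨ cong (ℤ._* v) xv≡e ⟩
      e ℤ.* v           ∎
      where open ≡-Reasoning

    %-pred : ∀ x c N .{{_ : NonZero N}} → x + 1 ≡ c * N → x % N ≡ (N ∸ 1) % N
    %-pred x zero    N       x+1≡0 = ⊥-elim (ℕ.1+n≢0 (trans (ℕ.+-comm 1 x) x+1≡0))
    %-pred x (suc c) (suc M) x+1≡cN = trans (cong (_% suc M) (ℕ.suc-injective (trans (ℕ.+-comm 1 x) x+1≡cN)))
                                            (ℕ.[m+kn]%n≡m%n M c (suc M))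

    %-succ : ∀ x c N .{{_ : NonZero N}} → x ≡ c * N + 1 → x % N ≡ 1 % N
    %-succ x c N x≡cN+1 = trans (cong (_% N) (trans x≡cN+1 (ℕ.+-comm (c * N) 1))) (ℕ.[m+kn]%n≡m%n 1 c N)

    %-negate : ∀ N a b .{{_ : NonZero N}} → N ≡ a + b → 1 ≤ a → ((N ∸ 1) * a) % N ≡ b % N
    %-negate N (suc u) b refl _ = trans (cong (_% suc (u + b)) (regroup u b)) (ℕ.[m+kn]%n≡m%n b u (suc (u + b)))
      where
      regroup : ∀ u b → (u + b) * suc u ≡ b + u * suc (u + b)
      regroup = solve-∀

  jacobi-convergent : ∀ k → Odd (T (suc k)) → jacobi (S (suc k)) (T (suc k)) ≡ (if even? k then χ (T (suc k)) ℤ.* V k else V k)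
  jacobi-convergent k odd with even? k | determinant k
  ... | true  | det = *-sign⁻¹ (begin
    jacobi (S (suc k)) N ℤ.* V k    ≡⟨ jacobi-* odd (S (suc k)) (T k) ⟨
    jacobi (S (suc k) * T k) N      ≡⟨ jacobi-% odd _ (N ∸ 1) (%-pred (S (suc k) * T k) (S k) N det) ⟩
    jacobi (N ∸ 1) N                ≡⟨ jacobi-[n-1] odd ⟩
    χ N                             ∎) (IsSign⇒*-self (V-isSign k odd))
    where
    open ≡-Reasoning
    N = T (suc k)
    instance _ = T-nonZero k
  ... | false | det = trans (*-sign⁻¹ (begin
    jacobi (S (suc k)) N ℤ.* V k    ≡⟨ jacobi-* odd (S (suc k)) (T k) ⟨
    jacobi (S (suc k) * T k) N      ≡⟨ jacobi-% odd _ 1 (%-succ (S (suc k) * T k) (S k) N det) ⟩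
    jacobi 1 N                      ≡⟨ jacobi-1 odd ⟩
    1ℤ                              ∎) (IsSign⇒*-self (V-isSign k odd))) (ℤ.*-identityˡ (V k))
    where
    open ≡-Reasoning
    N = T (suc k)
    instance _ = T-nonZero k

  V-step : ∀ k → Odd (T (suc k)) → Odd (T (suc (suc k))) → V (suc k) ≡ ε (T (suc k)) (T (suc (suc k))) ℤ.* V k
  V-step k odd₁ odd₂ = *-sign⁻¹ (begin
    V (suc k) ℤ.* V k                                                ≡⟨ cong (V (suc k) ℤ.*_) (jacobi-% odd₁ _ (T k) (T-% k)) ⟨
    jacobi (T (suc k)) (T (suc (suc k))) ℤ.* jacobi (T (suc (suc k))) (T (suc k))
                                                                     ≡⟨ jacobi-reciprocity odd₁ odd₂ (coprime-T-T (suc k)) ⟩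
    ε (T (suc k)) (T (suc (suc k)))                                  ∎) (IsSign⇒*-self (V-isSign k odd₁))
    where
    open ≡-Reasoning
    instance _ = T-nonZero k

  V-skip : ∀ k → Odd (T (suc k)) → Odd (T (suc (suc (suc k)))) → eCF (suc (suc k)) ≡ 1 →
           V (suc (suc k)) ≡ χ (T (suc (suc (suc k)))) ℤ.* (ε (T (suc k)) (T (suc (suc (suc k)))) ℤ.* V k)
  V-skip k oddB oddN a≡1 = begin
    V (suc (suc k))                 ≡⟨ *-sign⁻¹ (trans (ℤ.*-comm (V (suc (suc k))) (χ N)) χN*V≡ε*V) (-1^-*-self ⌊ N /2⌋) ⟩
    ε B N ℤ.* V k ℤ.* χ N           ≡⟨ ℤ.*-comm (ε B N ℤ.* V k) (χ N) ⟩
    χ N ℤ.* (ε B N ℤ.* V k)         ∎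
    where
    open ≡-Reasoning
    N = T (suc (suc (suc k)))
    A = T (suc (suc k))
    B = T (suc k)
    instance
      _ = T-nonZero k
      _ = T-nonZero (suc (suc k))
    N≡A+B : N ≡ A + B
    N≡A+B = T-step₁ (suc k) a≡1
    jacobi-B-N : jacobi B N ≡ χ N ℤ.* V (suc (suc k))
    jacobi-B-N = begin
      jacobi B N                   ≡⟨ jacobi-% oddN B ((N ∸ 1) * A) (sym (%-negate N A B N≡A+B (T-positive (suc k)))) ⟩
      jacobi ((N ∸ 1) * A) N       ≡⟨ jacobi-* oddN (N ∸ 1) A ⟩
      jacobi (N ∸ 1) N ℤ.* V (suc (suc k)) ≡⟨ cong (ℤ._* V (suc (suc k))) (jacobi-[n-1] oddN) ⟩
      χ N ℤ.* V (suc (suc k))      ∎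
    jacobi-N-B : jacobi N B ≡ V k
    jacobi-N-B = jacobi-% oddB N (T k) (trans (cong (_% B) N≡A+B) (trans (ℕ.[m+n]%n≡m%n A B) (T-% k)))
    χN*V≡ε*V : χ N ℤ.* V (suc (suc k)) ≡ ε B N ℤ.* V k
    χN*V≡ε*V = *-sign⁻¹ (trans (cong₂ ℤ._*_ (sym jacobi-B-N) (sym jacobi-N-B)) (jacobi-reciprocity oddB oddN (coprime-T-T₂ (suc k) a≡1)))
                 (IsSign⇒*-self (V-isSign k oddB))

  Periodic : ∀ {a} {A : Set a} → (ℕ → A) → ℕ → Set a
  Periodic f n = ∀ k → f (k + n) ≡ f k

  module _ {a} {A : Set a} {f : ℕ → A} {n : ℕ} (periodic : Periodic f n) where

    periodic-+* : ∀ k q → f (k + q * n) ≡ f k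
    periodic-+* k zero    = cong f (ℕ.+-identityʳ k)
    periodic-+* k (suc q) = trans (cong f (shift k q n)) (trans (periodic (k + q * n)) (periodic-+* k q))
      where
      shift : ∀ k q n → k + suc q * n ≡ k + q * n + n
      shift = solve-∀

    periodic-% : .{{_ : NonZero n}} → ∀ k → f k ≡ f (k % n)
    periodic-% k = trans (cong f (ℕ.m≡m%n+[m/n]*n k n)) (periodic-+* (k % n) (k / n))

  -- (T k % 4, T (k + 1) % 4), computed by the recurrence for T reduced modulo 4 so that
  -- evaluating it, as the finite checks below do, never builds the large T k
  T₄ : ℕ → ℕ × ℕ
  T₄ zero    = 0 , 1
  T₄ (suc k) = proj₂ (T₄ k) , (eCF (suc k) % 4 * proj₂ (T₄ k) + proj₁ (T₄ k)) % 4

  t₄ : ℕ → ℕ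
  t₄ k = proj₁ (T₄ k)

  T₄-correct : ∀ k → T₄ k ≡ (T k % 4 , T (suc k) % 4)
  T₄-correct zero    = refl
  T₄-correct (suc k) rewrite T₄-correct k = cong (T (suc k) % 4 ,_) (begin
    (eCF (suc k) % 4 * (T (suc k) % 4) + T k % 4) % 4          ≡⟨ ℕ.%-distribˡ-+ (eCF (suc k) % 4 * (T (suc k) % 4)) (T k % 4) 4 ⟩
    ((eCF (suc k) % 4 * (T (suc k) % 4)) % 4 + T k % 4 % 4) % 4 ≡⟨ cong₂ (λ x y → (x + y) % 4)
                                                                      (sym (ℕ.%-distribˡ-* (eCF (suc k)) (T (suc k)) 4))
                                                                      (ℕ.m%n%n≡m%n (T k) 4) ⟩
    ((eCF (suc k) * T (suc k)) % 4 + T k % 4) % 4              ≡⟨ ℕ.%-distribˡ-+ (eCF (suc k) * T (suc k)) (T k) 4 ⟨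
    (eCF (suc k) * T (suc k) + T k) % 4                        ∎)
    where open ≡-Reasoning

  t₄≡T%4 : ∀ k → t₄ k ≡ T k % 4
  t₄≡T%4 k = cong proj₁ (T₄-correct k)

  t₄%2≡T%2 : ∀ k → t₄ k % 2 ≡ T k % 2
  t₄%2≡T%2 k = trans (cong (_% 2) (t₄≡T%4 k)) (ℕ.m∣n⇒o%n%m≡o%m 2 4 (T k) (divides 2 refl))

  T₄-periodic : Periodic T₄ 24
  T₄-periodic zero    = refl
  T₄-periodic (suc k) rewrite T₄-periodic k | eCF-+24 k = refl

  t₄-periodic : Periodic t₄ 24
  t₄-periodic k = cong proj₁ (T₄-periodic k)

  -- checked on one period: whenever t_k is even, a_{k+1} = 1
  EvenDenominatorRule : ℕ → Set
  EvenDenominatorRule k = t₄ (suc k) % 2 ≡ 0 → eCF (suc k) % 4 % 2 ≡ 1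

  evenDenominatorRule-period : All EvenDenominatorRule (upTo 24)
  evenDenominatorRule-period = from-yes (all? (λ k → (t₄ (suc k) % 2 ℕ.≟ 0) →-dec (eCF (suc k) % 4 % 2 ℕ.≟ 1)) (upTo 24))

  even-T⇒eCF≡1 : ∀ k → T (suc k) % 2 ≡ 0 → eCF (suc k) ≡ 1
  even-T⇒eCF≡1 k T%2≡0 = odd-eCF≡1 k (trans (sym (ℕ.m∣n⇒o%n%m≡o%m 2 4 (eCF (suc k)) (divides 2 refl)))
    (rule (trans (t₄%2≡T%2 (suc k)) T%2≡0)))
    where
    rule : EvenDenominatorRule k
    rule = subst (λ P → P) (sym (periodic-% rule-periodic k)) (All.lookup evenDenominatorRule-period (∈-upTo⁺ (ℕ.m%n<n k 24)))
      where
      rule-periodic : Periodic EvenDenominatorRule 24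
      rule-periodic k = cong₂ (λ x y → x % 2 ≡ 0 → y % 2 ≡ 1) (t₄-periodic (suc k)) (eCF-+24 k)

  -- V (k + 2) from V k and V (k + 1), following V-step when t_{k+1} is odd and V-skip when it is even
  nextV : (parity t₁ t₂ t₃ : ℕ) (v₀ v₁ : ℤ) → ℤ
  nextV 1 t₁ t₂ t₃ v₀ v₁ = ε t₂ t₃ ℤ.* v₁
  nextV _ t₁ t₂ t₃ v₀ v₁ = χ t₃ ℤ.* (ε t₁ t₃ ℤ.* v₀)

  -- (V k, V (k + 1)) as predicted from the residues t₄
  V₄ : ℕ → ℤ × ℤ
  V₄ zero    = 1ℤ , ε (t₄ 1) (t₄ 2)
  V₄ (suc k) = proj₂ (V₄ k) , nextV (t₄ (2 + k) % 2) (t₄ (1 + k)) (t₄ (2 + k)) (t₄ (3 + k)) (proj₁ (V₄ k)) (proj₂ (V₄ k))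

  v₄ : ℕ → ℤ
  v₄ k = proj₁ (V₄ k)

  V₄-periodic : Periodic V₄ 24
  V₄-periodic zero    = refl
  V₄-periodic (suc k) = cong₂ (λ (t₁ , t₂ , t₃) v → proj₂ v , nextV (t₂ % 2) t₁ t₂ t₃ (proj₁ v) (proj₂ v))
    (cong₂ _,_ (t₄-periodic (1 + k)) (cong₂ _,_ (t₄-periodic (2 + k)) (t₄-periodic (3 + k)))) (V₄-periodic k)

  ε-t₄ : ∀ a b → ε (T a) (T b) ≡ ε (t₄ a) (t₄ b)
  ε-t₄ a b = trans (ε-%4 (T a) (T b)) (sym (cong₂ ε (t₄≡T%4 a) (t₄≡T%4 b)))

  χ-t₄ : ∀ a → χ (T a) ≡ χ (t₄ a)
  χ-t₄ a = trans (χ-%4 (T a)) (sym (cong χ (t₄≡T%4 a)))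

  V≡v₄ : ∀ k → (Odd (T (suc k)) → V k ≡ v₄ k) × (Odd (T (2 + k)) → V (suc k) ≡ v₄ (suc k))
  V≡v₄ zero    = (λ _ → refl) , (λ odd₂ → trans (V-step 0 (0 , refl) odd₂) (trans (ℤ.*-identityʳ _) (ε-t₄ 1 2)))
  V≡v₄ (suc k) = proj₂ (V≡v₄ k) , V≡v₄-next
    where
    next-at : ℕ → ℤ
    next-at parity = nextV parity (t₄ (1 + k)) (t₄ (2 + k)) (t₄ (3 + k)) (v₄ k) (v₄ (suc k))

    V≡v₄-next : Odd (T (3 + k)) → V (2 + k) ≡ v₄ (2 + k)
    V≡v₄-next odd₃ with T (2 + k) % 2 in eq | ℕ.m%n<n (T (2 + k)) 2
    ... | 1 | _ = begin
      V (2 + k)                                    ≡⟨ V-step (suc k) odd₂ odd₃ ⟩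
      ε (T (2 + k)) (T (3 + k)) ℤ.* V (suc k)      ≡⟨ cong₂ ℤ._*_ (ε-t₄ (2 + k) (3 + k)) (proj₂ (V≡v₄ k) odd₂) ⟩
      ε (t₄ (2 + k)) (t₄ (3 + k)) ℤ.* v₄ (suc k)   ≡⟨ cong next-at t₄%2≡1 ⟨
      v₄ (2 + k)                                   ∎
      where
      open ≡-Reasoning
      odd₂ : Odd (T (2 + k))
      odd₂ = %2≡1⇒Odd eq
      t₄%2≡1 : t₄ (2 + k) % 2 ≡ 1
      t₄%2≡1 = trans (t₄%2≡T%2 (2 + k)) eq
    ... | 0 | _ = begin
      V (2 + k)                                                        ≡⟨ V-skip k odd₁ odd₃ (even-T⇒eCF≡1 (suc k) eq) ⟩
      χ (T (3 + k)) ℤ.* (ε (T (1 + k)) (T (3 + k)) ℤ.* V k)            ≡⟨ cong₂ (λ x y → x ℤ.* (y ℤ.* V k)) (χ-t₄ (3 + k)) (ε-t₄ (1 + k) (3 + k)) ⟩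
      χ (t₄ (3 + k)) ℤ.* (ε (t₄ (1 + k)) (t₄ (3 + k)) ℤ.* V k)
        ≡⟨ cong (λ v → χ (t₄ (3 + k)) ℤ.* (ε (t₄ (1 + k)) (t₄ (3 + k)) ℤ.* v)) (proj₁ (V≡v₄ k) odd₁) ⟩
      χ (t₄ (3 + k)) ℤ.* (ε (t₄ (1 + k)) (t₄ (3 + k)) ℤ.* v₄ k)        ≡⟨ cong next-at t₄%2≡0 ⟨
      v₄ (2 + k)                                                       ∎
      where
      open ≡-Reasoning
      t₄%2≡0 : t₄ (2 + k) % 2 ≡ 0
      t₄%2≡0 = trans (t₄%2≡T%2 (2 + k)) eq
      -- t_{k+2} = a t_{k+1} + t_k with t_{k+1} even, so t_k is odd along with t_{k+2}
      odd₁ : Odd (T (suc k))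
      odd₁ = %2≡1⇒Odd (trans (sym (ℕ.%-remove-+ˡ (T (suc k)) (∣n⇒∣m*n (eCF (2 + k)) (m%n≡0⇒n∣m _ 2 eq)))) (Odd⇒%2≡1 odd₃))
    ... | suc (suc _) | s≤s (s≤s ())

  even?-periodic : Periodic even? 24
  even?-periodic zero    = refl
  even?-periodic (suc k) = cong not (even?-periodic k)

  v₄-periodic : Periodic v₄ 24
  v₄-periodic k = cong proj₁ (V₄-periodic k)

  J₄-given-parity : ℕ → ℕ → JVal
  J₄-given-parity k r = if r ≡ᵇ 0 then star else symbol (if even? k then χ (t₄ (suc k)) ℤ.* v₄ k else v₄ k)

  J₄ : ℕ → JVal
  J₄ k = J₄-given-parity k (t₄ (suc k) % 2)

  J₄-periodic : Periodic J₄ 24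
  J₄-periodic k = cong₂ (λ t (b , v) → if t % 2 ≡ᵇ 0 then star else symbol (if b then χ t ℤ.* v else v))
    (t₄-periodic (suc k)) (cong₂ _,_ (even?-periodic k) (v₄-periodic k))

  eJacobiSeq≡J₄ : ∀ k → eJacobiSeq k ≡ J₄ k
  eJacobiSeq≡J₄ k with T (suc k) % 2 in eq | ℕ.m%n<n (T (suc k)) 2
  ... | 0 | _ = cong (J₄-given-parity k) (sym (trans (t₄%2≡T%2 (suc k)) eq))
  ... | 1 | _ = begin
    symbol (jacobi (S (suc k)) (T (suc k)))                                    ≡⟨ cong symbol (jacobi-convergent k odd) ⟩
    symbol (if even? k then χ (T (suc k)) ℤ.* V k else V k)                    ≡⟨ cong symbol (predicted (even? k)) ⟩
    symbol (if even? k then χ (t₄ (suc k)) ℤ.* v₄ k else v₄ k)                 ≡⟨ cong (J₄-given-parity k) (trans (t₄%2≡T%2 (suc k)) eq) ⟨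
    J₄ k                                                                       ∎
    where
    open ≡-Reasoning
    odd : Odd (T (suc k))
    odd = %2≡1⇒Odd eq
    predicted : ∀ b → (if b then χ (T (suc k)) ℤ.* V k else V k) ≡ (if b then χ (t₄ (suc k)) ℤ.* v₄ k else v₄ k)
    predicted true  = cong₂ ℤ._*_ (χ-t₄ (suc k)) (proj₁ (V≡v₄ k) odd)
    predicted false = proj₁ (V≡v₄ k) odd
  ... | suc (suc _) | s≤s (s≤s ())

  eJacobiSeq-periodic : ∀ k → eJacobiSeq k ≡ eJacobiSeq (k + 24)
  eJacobiSeq-periodic k = trans (eJacobiSeq≡J₄ k) (trans (sym (J₄-periodic k)) (sym (eJacobiSeq≡J₄ (k + 24))))

  _≟ᴶ_ : DecidableEquality JVal
  symbol a ≟ᴶ symbol b = Dec.map′ (cong symbol) (λ { refl → refl }) (a ℤ.≟ b)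
  symbol _ ≟ᴶ star     = no (λ ())
  star     ≟ᴶ symbol _ = no (λ ())
  star     ≟ᴶ star     = yes refl

  shift-detected : All (λ p → Any (λ r → J₄ r ≢ J₄ (r + p)) (upTo 3)) (range 23)
  shift-detected = from-yes (all? (λ p → any? (λ r → ¬? (J₄ r ≟ᴶ J₄ (r + p))) (upTo 3)) (range 23))

  eJacobiSeq-minimal : ∀ p k₀ → 0 < p → (∀ k → k₀ ≤ k → eJacobiSeq k ≡ eJacobiSeq (k + p)) → 24 ≤ p
  eJacobiSeq-minimal p k₀ 0<p periodic with 24 ℕ.≤? p
  ... | yes 24≤p = 24≤p
  ... | no  24≰p with find (All.lookup shift-detected (∈-range⁺ 0<p (ℕ.≤-pred (ℕ.≰⇒> 24≰p))))
  ... | r , _ , J₄r≢J₄[r+p] = ⊥-elim (J₄r≢J₄[r+p] (begin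
    J₄ r                          ≡⟨ periodic-+* J₄-periodic r k₀ ⟨
    J₄ (r + k₀ * 24)              ≡⟨ eJacobiSeq≡J₄ (r + k₀ * 24) ⟨
    eJacobiSeq (r + k₀ * 24)      ≡⟨ periodic (r + k₀ * 24) (ℕ.≤-trans (ℕ.m≤m*n k₀ 24) (ℕ.m≤n+m (k₀ * 24) r)) ⟩
    eJacobiSeq (r + k₀ * 24 + p)  ≡⟨ eJacobiSeq≡J₄ (r + k₀ * 24 + p) ⟩
    J₄ (r + k₀ * 24 + p)          ≡⟨ cong J₄ (swap r (k₀ * 24) p) ⟩
    J₄ (r + p + k₀ * 24)          ≡⟨ periodic-+* J₄-periodic (r + p) k₀ ⟩
    J₄ (r + p)                    ∎))
    where
    open ≡-Reasoning
    swap : ∀ a b c → a + b + c ≡ a + c + b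
    swap = solve-∀

open import Data.Nat using (_+_; _≤_; _<_)
open import Data.Product using (_×_; _,_)
open import Relation.Binary.PropositionalEquality using (_≡_)
open import Defs

theorem1 : ((k : ℕ) → eJacobiSeq k ≡ eJacobiSeq (k + 24))
           × ((p k₀ : ℕ) → 0 < p → ((k : ℕ) → k₀ ≤ k → eJacobiSeq k ≡ eJacobiSeq (k + p)) → 24 ≤ p)
theorem1 = ContinuedFractionOfE.eJacobiSeq-periodic , ContinuedFractionOfE.eJacobiSeq-minimal
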